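{- Let $p$ be a prime, $n\ge 1$, $f\in\mathbb{Z}[x]$, and let $C$ be a cycle of size $k$ in $G(f,\mathbb{Z}_{p^n})$ with multiplier $\lambda=\lambda(C)$ and $\bar\lambda$ its image in $\mathbb{Z}_p$. Consider the lifted graph of $C$ in $G(f,\mathbb{Z}_{p^{n+1}})$. (1) If $\bar\lambda=0$, then the lifted graph of $C$ contains exactly one cycle, and it has size $k$. (2) If $\bar\lambda=1$, then the lifted graph of $C$ consists of only one cycle of size $kp$, or of $p$ cycles of size $k$; the latter case occurs if and only if $r_v=0$ for a vertex $v$ of $C$. (3) If $\bar\lambda\ne 0,1$, then the lifted graph of $C$ consists of one cycle of size $k$ and $(p-1)/m$ cycles of size $mk$, where $m$ is the multiplicative order of $\bar\lambda$ in $\mathbb{Z}_p^\times$ (the least positive integer with $\bar\lambda^m=1$).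
   Context: $\mathbb{Z}_N:=\mathbb{Z}/N\mathbb{Z}$; $f$ is regarded as a function on each $\mathbb{Z}_N$, and $f^i$ denotes the $i$-th iterate. The functional graph $G(f,\mathbb{Z}_N)$ has vertex set $\mathbb{Z}_N$ and directed edges $(v,f(v))$. A cycle of size $k$ is a set of $k$ distinct vertices $v_0,\dots,v_{k-1}$ with $f(v_i)=v_{i+1}$ (indices mod $k$). Lifted graph: for $n'>n$ let $\pi:\mathbb{Z}_{p^{n'}}\to\mathbb{Z}_{p^n}$ be the natural projection; for a subgraph $S$ of $G(f,\mathbb{Z}_{p^n})$ with vertex set $V$, the lifted graph of $S$ in $G(f,\mathbb{Z}_{p^{n'}})$ is the subgraph of $G(f,\mathbb{Z}_{p^{n'}})$ induced on $\pi^{ -1}(V)$; a lifted cycle of $S$ is a cycle in this lifted graph. Multiplier: for a cycle $C=\{v_0,\dots,v_{k-1}\}$ of size $k$, $\lambda(C):=(f^k)'(v_0)=\prod_{v\in C}f'(v)$ (derivatives of the integer polynomials, evaluated at representatives), and $\bar\lambda(C)$ is its image in $\mathbb{Z}_p$ (independent of choices). For a vertex $v$ of a cycle $C$ of size $k$ in $G(f,\mathbb{Z}_{p^n})$, let $a_v\in[0,p^n)$ be the unique representative of $v$ and define $r_v\in[0,p)$ as the remainder of the integer $(f^k(a_v)-a_v)/p^n$ upon division by $p$; equivalently $f^k(a_v)\equiv a_v+r_vp^n \pmod{p^{n+1}}$. -}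

module Defs where

open import Data.Nat as ℕ using (ℕ; zero; suc; _<_; _≤_; _^_; _∸_)
import Data.Nat.DivMod as ℕD
open import Data.Integer as ℤ using (ℤ; +_)
open import Data.Integer.Base using (_/ℕ_; _%ℕ_)
open import Data.Fin using (Fin; toℕ; fromℕ<)
import Data.Fin as Fin
open import Data.List using (List; []; _∷_)
open import Data.Product using (Σ; ∃; _×_; _,_)
open import Function.Bundles using (_⇔_)
open import Function.Definitions using (Injective)
open import Relation.Binary.PropositionalEquality using (_≡_; _≢_)
open import Relation.Nullary using (¬_)

-- Polynomials in ℤ[x] as coefficient lists [a₀, a₁, a₂, …] (f = Σ aᵢ xⁱ).
Poly : Set
Poly = List ℤ

eval : Poly → ℤ → ℤ
eval []       x = + 0
eval (a ∷ as) x = a ℤ.+ x ℤ.* eval as x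

derivFrom : ℕ → Poly → Poly
derivFrom i []       = []
derivFrom i (b ∷ bs) = (+ i) ℤ.* b ∷ derivFrom (suc i) bs

deriv : Poly → Poly
deriv []       = []
deriv (a ∷ as) = derivFrom 1 as

iter : {A : Set} → (A → A) → ℕ → A → A
iter g zero    x = x
iter g (suc i) x = g (iter g i x)

-- reductions (the modulus 0 case is never used; N = p^n ≥ 2 below)
_modℤ_ : ℤ → ℕ → ℕ
z modℤ zero    = 0
z modℤ (suc m) = z %ℕ suc m

_divℤ_ : ℤ → ℕ → ℤ
z divℤ zero    = + 0
z divℤ (suc m) = z /ℕ suc m

_modN_ : ℕ → ℕ → ℕ
x modN zero    = x
x modN (suc m) = x ℕ.% suc m

-- f as a function on ℤ_N, vertices of G(f, ℤ_N) represented by 0 … N-1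
fmap : Poly → ℕ → ℕ → ℕ
fmap f N v = eval f (+ v) modℤ N

next : {k : ℕ} → Fin k → Fin k
next {suc m} i = fromℕ< (ℕD.m%n<n (suc (toℕ i)) (suc m))

record Cycle (f : Poly) (N k : ℕ) : Set where
  field
    size>0 : 0 < k
    vert   : Fin k → ℕ
    bound  : ∀ i → vert i < N
    inj    : Injective _≡_ _≡_ vert
    step   : ∀ i → fmap f N (vert i) ≡ vert (next i)
open Cycle public

_∈C_ : {f : Poly} {N k : ℕ} → ℕ → Cycle f N k → Set
x ∈C C = ∃ λ i → vert C i ≡ x

SameCycle : {f : Poly} {N k k' : ℕ} → Cycle f N k → Cycle f N k' → Set
SameCycle C D = ∀ x → (x ∈C C) ⇔ (x ∈C D)

LiftedVertex : {f : Poly} {N k : ℕ} → (M : ℕ) → Cycle f N k → ℕ → Set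
LiftedVertex {N = N} M C x = (x < M) × ((x modN N) ∈C C)

-- a cycle in G(f, ℤ_M) lying in the lifted graph of C (induced subgraph on π⁻¹(V(C)))
LiftedCycle : {f : Poly} {N k k' : ℕ} {M : ℕ} → Cycle f N k → Cycle f M k' → Set
LiftedCycle {M = M} C D = ∀ i → LiftedVertex M C (vert D i)

-- the lifted graph of C in G(f,ℤ_M) consists exactly of t pairwise distinct cycles
-- of sizes sz 0, …, sz (t-1) (every vertex of the lifted graph lies on one of them;
-- the edges are then automatically the cycle edges, since the graph is functional)
ConsistsOf : {f : Poly} {N k : ℕ} → (M : ℕ) → Cycle f N k → (t : ℕ) → (Fin t → ℕ) → Set
ConsistsOf {f} M C t sz =
  Σ ((j : Fin t) → Cycle f M (sz j)) λ D →
    (∀ j → LiftedCycle C (D j)) ×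
    (∀ j j' → j ≢ j' → ¬ SameCycle (D j) (D j')) ×
    (∀ x → LiftedVertex M C x → ∃ λ j → x ∈C D j)

ExactlyOneCycle : {f : Poly} {N k : ℕ} → (M : ℕ) → Cycle f N k → ℕ → Set
ExactlyOneCycle {f} M C k' =
  Σ (Cycle f M k') λ D → LiftedCycle C D ×
    (∀ k'' (E : Cycle f M k'') → LiftedCycle C E → SameCycle E D)

prodFin : {k : ℕ} → (Fin k → ℤ) → ℤ
prodFin {zero}  g = + 1
prodFin {suc k} g = g Fin.zero ℤ.* prodFin (λ i → g (Fin.suc i))
  where import Data.Fin as Fin

multiplier : {f : Poly} {N k : ℕ} → Cycle f N k → ℤ
multiplier {f} C = prodFin (λ i → eval (deriv f) (+ vert C i))

multiplierBar : {f : Poly} {N k : ℕ} → ℕ → Cycle f N k → ℕ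
multiplierBar p C = multiplier C modℤ p

rVertex : {f : Poly} {k : ℕ} → (p n : ℕ) → Cycle f (p ^ n) k → Fin k → ℕ
rVertex {f} {k} p n C i =
  ((iter (eval f) k (+ a) ℤ.- + a) divℤ (p ^ n)) modℤ p
  where a = vert C i

IsMultOrder : ℕ → ℕ → ℕ → Set
IsMultOrder p a m =
  (0 < m) × ((a ^ m) modN p ≡ 1) × (∀ m' → 0 < m' → m' < m → (a ^ m') modN p ≢ 1)

firstThen : {t : ℕ} → ℕ → ℕ → Fin (suc t) → ℕ
firstThen a b Fin.zero    = a
firstThen a b (Fin.suc _) = b

-- Write N = p^n, M = p^(n+1) and a s for the s-th vertex of C (indices mod k). The vertices of
-- the lifted graph are the lifts a s + t N with 0 ≤ t < p. Taylor's formula modulo M (the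
-- quadratic term vanishes because p ∣ N) shows that f^k maps the fibre over a s to itself by the
-- affine map t ↦ r_s + λ̄ t of ℤ_p, where λ̄ is the multiplier mod p and r_s the remainder r_v of
-- v = a s. A cycle of length d of this return map lifts to a cycle of length d k, different
-- cycles of the return map lift to different cycles, and every lifted vertex reaches every fibre;
-- so when all return maps are periodic, every lifted vertex lies on one of the lifted cycles.
-- Everything thus reduces to the cycles of t ↦ r + λ̄ t on ℤ_p. For λ̄ = 0 the map is constant,
-- so every lifted cycle passes through the lift of its fixed point. For λ̄ = 1 it is the identity
-- if r = 0 and a single p-cycle otherwise. For λ̄ ≠ 0, 1 it has a fixed point t*, and translating
-- by t* conjugates it to t ↦ λ̄ t, which fixes 0 and permutes the other residues along the
-- (p - 1)/m cosets of ⟨λ̄⟩ in ℤ_p^×, each of size m.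

module Submission where

open import Defs

module Congruence where

  open import Data.Nat.Base as ℕ using (ℕ; suc; _<_; _≤_; _∸_; _%_; NonZero)
  import Data.Nat.Properties as ℕ
  import Data.Nat.Divisibility as ℕ
  open import Data.Nat.DivMod using (m<n⇒m%n≡m)
  open import Data.Nat.Divisibility using (n∣m⇒m%n≡0)
  open import Data.Nat.Primality using (Prime; euclidsLemma; prime⇒nonZero)
  open import Data.Nat.Coprimality using (prime⇒coprime; coprime-Bézout)
  open import Data.Nat.GCD using (module Bézout)
  open import Data.Integer.Base using (ℤ; +_; 0ℤ; 1ℤ; _+_; _*_; -_; _-_; ∣_∣; _%ℕ_; _/ℕ_)
  import Data.Integer.Properties as ℤ
  open import Data.Integer.DivMod using (a≡a%ℕn+[a/ℕn]*n; n%ℕd<d)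
  open import Data.Integer.Divisibility.Signed
    using (_∣_; divides; ∣-trans; ∣m∣n⇒∣m+n; ∣m⇒∣-m; ∣n⇒∣m*n; ∣m⇒∣m*n; *-monoˡ-∣; ∣ᵤ⇒∣; ∣⇒∣ᵤ)
  open import Data.Integer.Tactic.RingSolver using (solve-∀)
  open import Data.Product using (∃; _,_; map₂)
  open import Data.Sum using (_⊎_; inj₁; inj₂)
  open import Level using (0ℓ)
  open import Relation.Binary.Bundles using (Setoid)
  open import Relation.Binary.Structures using (IsEquivalence)
  open import Relation.Nullary using (¬_; contradiction)
  open import Relation.Binary.PropositionalEquality
    using (_≡_; refl; sym; trans; cong; subst; subst₂; module ≡-Reasoning)
  import Relation.Binary.Reasoning.Setoid as SetoidReasoning

  infix 4 _≡_mod_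

  record _≡_mod_ (x y : ℤ) (d : ℕ) : Set where
    constructor congruent
    field divides-difference : + d ∣ x - y
  open _≡_mod_ public

  module _ {d : ℕ} where

    private
      divisible-by-≡ : ∀ {x y u} → u ≡ x - y → + d ∣ u → x ≡ y mod d
      divisible-by-≡ refl h = congruent h

      x-x≡0 : ∀ x → 0ℤ ≡ x - x
      x-x≡0 = solve-∀

      -[x-y]≡y-x : ∀ x y → - (x - y) ≡ y - x
      -[x-y]≡y-x = solve-∀

      [x-y]+[y-z]≡x-z : ∀ x y z → (x - y) + (y - z) ≡ x - z
      [x-y]+[y-z]≡x-z = solve-∀

      +-interchange : ∀ x x' y y' → (x - x') + (y - y') ≡ (x + y) - (x' + y')
      +-interchange = solve-∀

      *-interchange : ∀ x x' y y' → (x - x') * y + x' * (y - y') ≡ x * y - x' * y'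
      *-interchange = solve-∀

    ≡⇒≡-mod : ∀ {x y} → x ≡ y → x ≡ y mod d
    ≡⇒≡-mod {x} refl = divisible-by-≡ (x-x≡0 x) (divides 0ℤ refl)

    ≡-mod-refl : ∀ {x} → x ≡ x mod d
    ≡-mod-refl = ≡⇒≡-mod refl

    ≡-mod-sym : ∀ {x y} → x ≡ y mod d → y ≡ x mod d
    ≡-mod-sym {x} {y} h = divisible-by-≡ (-[x-y]≡y-x x y) (∣m⇒∣-m (divides-difference h))

    ≡-mod-trans : ∀ {x y z} → x ≡ y mod d → y ≡ z mod d → x ≡ z mod d
    ≡-mod-trans {x} {y} {z} h h' = divisible-by-≡ ([x-y]+[y-z]≡x-z x y z) (∣m∣n⇒∣m+n (divides-difference h) (divides-difference h'))

    +-cong-mod : ∀ {x x' y y'} → x ≡ x' mod d → y ≡ y' mod d → x + y ≡ x' + y' mod d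
    +-cong-mod {x} {x'} {y} {y'} h h' = divisible-by-≡ (+-interchange x x' y y') (∣m∣n⇒∣m+n (divides-difference h) (divides-difference h'))

    *-cong-mod : ∀ {x x' y y'} → x ≡ x' mod d → y ≡ y' mod d → x * y ≡ x' * y' mod d
    *-cong-mod {x} {x'} {y} {y'} h h' =
      divisible-by-≡ (*-interchange x x' y y') (∣m∣n⇒∣m+n (∣m⇒∣m*n y (divides-difference h)) (∣n⇒∣m*n x' (divides-difference h')))

    +-congˡ-mod : ∀ a {x y} → x ≡ y mod d → a + x ≡ a + y mod d
    +-congˡ-mod a = +-cong-mod (≡-mod-refl {a})

    +-congʳ-mod : ∀ a {x y} → x ≡ y mod d → x + a ≡ y + a mod d
    +-congʳ-mod a h = +-cong-mod h (≡-mod-refl {a})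

    *-congˡ-mod : ∀ a {x y} → x ≡ y mod d → a * x ≡ a * y mod d
    *-congˡ-mod a = *-cong-mod (≡-mod-refl {a})

    *-congʳ-mod : ∀ a {x y} → x ≡ y mod d → x * a ≡ y * a mod d
    *-congʳ-mod a h = *-cong-mod h (≡-mod-refl {a})

  ≡-mod-isEquivalence : ∀ d → IsEquivalence (_≡_mod d)
  ≡-mod-isEquivalence d = record { refl = ≡-mod-refl ; sym = ≡-mod-sym ; trans = ≡-mod-trans }

  ≡-mod-setoid : ℕ → Setoid 0ℓ 0ℓ
  ≡-mod-setoid d = record { isEquivalence = ≡-mod-isEquivalence d }

  module ≡-mod-Reasoning (d : ℕ) = SetoidReasoning (≡-mod-setoid d)

  module _ {d : ℕ} where

    private
      [x+w*d]-x≡w*d : ∀ x w D → (x + w * D) - x ≡ w * D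
      [x+w*d]-x≡w*d = solve-∀

      [a+x]-[a+y]≡x-y : ∀ a x y → (a + x) - (a + y) ≡ x - y
      [a+x]-[a+y]≡x-y = solve-∀

      [x-y]*c≡x*c-y*c : ∀ x y c → (x - y) * c ≡ x * c - y * c
      [x-y]*c≡x*c-y*c = solve-∀

    +-multiple-mod : ∀ x w → x + w * + d ≡ x mod d
    +-multiple-mod x w = congruent (divides w ([x+w*d]-x≡w*d x w (+ d)))

    +-cancelˡ-mod : ∀ a {x y} → a + x ≡ a + y mod d → x ≡ y mod d
    +-cancelˡ-mod a {x} {y} (congruent h) = congruent (subst (+ d ∣_) ([a+x]-[a+y]≡x-y a x y) h)

    +-cancelʳ-mod : ∀ a {x y} → x + a ≡ y + a mod d → x ≡ y mod d
    +-cancelʳ-mod a {x} {y} h = +-cancelˡ-mod a (≡-mod-trans (≡⇒≡-mod (ℤ.+-comm a x)) (≡-mod-trans h (≡⇒≡-mod (ℤ.+-comm y a))))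

    m≡n⇒m-n≡0-mod : ∀ {x y} → x ≡ y mod d → x - y ≡ 0ℤ mod d
    m≡n⇒m-n≡0-mod {x} {y} (congruent h) = congruent (subst (+ d ∣_) (sym (ℤ.+-identityʳ (x - y))) h)

    m-n≡0⇒m≡n-mod : ∀ {x y} → x - y ≡ 0ℤ mod d → x ≡ y mod d
    m-n≡0⇒m≡n-mod {x} {y} (congruent h) = congruent (subst (+ d ∣_) (ℤ.+-identityʳ (x - y)) h)

    *-scale-mod : ∀ c {x y} → x ≡ y mod d → x * + c ≡ y * + c mod (d ℕ.* c)
    *-scale-mod c {x} {y} (congruent h) = congruent (subst₂ _∣_ (sym (ℤ.pos-* d c)) ([x-y]*c≡x*c-y*c x y (+ c)) (*-monoˡ-∣ (+ c) h))

    ≡-mod-divisor : ∀ {c x y} → c ℕ.∣ d → x ≡ y mod d → x ≡ y mod c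
    ≡-mod-divisor c∣d (congruent h) = congruent (∣-trans (∣ᵤ⇒∣ c∣d) h)

    module _ .{{_ : NonZero d}} where

      %ℕ-mod : ∀ x → + (x %ℕ d) ≡ x mod d
      %ℕ-mod x = ≡-mod-sym (≡-mod-trans (≡⇒≡-mod (a≡a%ℕn+[a/ℕn]*n x d)) (+-multiple-mod _ (x /ℕ d)))

      private
        residue-≤ : ∀ {r s} → s ≤ r → r < d → + r ≡ + s mod d → r ≤ s
        residue-≤ {r} {s} s≤r r<d (congruent h) =
          ℕ.m∸n≡0⇒m≤n (trans (sym (m<n⇒m%n≡m r∸s<d)) (n∣m⇒m%n≡0 (r ∸ s) d d∣r∸s))
          where
          r∸s<d : r ∸ s < d
          r∸s<d = ℕ.≤-<-trans (ℕ.m∸n≤m r s) r<d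
          d∣r∸s : d ℕ.∣ r ∸ s
          d∣r∸s = ∣⇒∣ᵤ (subst (+ d ∣_) (trans (ℤ.m-n≡m⊖n r s) (ℤ.⊖-≥ s≤r)) h)

      residue-unique : ∀ {r s} → r < d → s < d → + r ≡ + s mod d → r ≡ s
      residue-unique {r} {s} r<d s<d h with ℕ.≤-total s r
      ... | inj₁ s≤r = ℕ.≤-antisym (residue-≤ s≤r r<d h) s≤r
      ... | inj₂ r≤s = ℕ.≤-antisym r≤s (residue-≤ r≤s s<d (≡-mod-sym h))

      ≡-mod⇒%ℕ≡ : ∀ {x y} → x ≡ y mod d → x %ℕ d ≡ y %ℕ d
      ≡-mod⇒%ℕ≡ {x} {y} h = residue-unique (n%ℕd<d x d) (n%ℕd<d y d)
        (≡-mod-trans (%ℕ-mod x) (≡-mod-trans h (≡-mod-sym (%ℕ-mod y))))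

      %≡%⇒≡-mod : ∀ {x y} → x % d ≡ y % d → + x ≡ + y mod d
      %≡%⇒≡-mod {x} {y} eq = ≡-mod-trans (≡-mod-sym (%ℕ-mod (+ x))) (≡-mod-trans (≡⇒≡-mod (cong +_ eq)) (%ℕ-mod (+ y)))

      ≡-mod⇒≡+quotient : ∀ {x y} → x ≡ y mod d → x ≡ y + ((x - y) /ℕ d) * + d
      ≡-mod⇒≡+quotient {x} {y} h = begin
        x                                      ≡⟨ x≡y+[x-y] x y ⟩
        y + (x - y)                            ≡⟨ cong (_+_ y) (a≡a%ℕn+[a/ℕn]*n (x - y) d) ⟩
        y + (+ ((x - y) %ℕ d) + q * + d)       ≡⟨ cong (λ r → y + (+ r + q * + d)) (trans (≡-mod⇒%ℕ≡ (m≡n⇒m-n≡0-mod h)) (m<n⇒m%n≡m (ℕ.>-nonZero⁻¹ d))) ⟩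
        y + (0ℤ + q * + d)                     ≡⟨ cong (_+_ y) (ℤ.+-identityˡ (q * + d)) ⟩
        y + q * + d                            ∎
        where
        open ≡-Reasoning
        q = (x - y) /ℕ d
        x≡y+[x-y] : ∀ x y → x ≡ y + (x - y)
        x≡y+[x-y] = solve-∀

  ≡0-mod⇒∣ : ∀ {d x} → x ≡ 0ℤ mod d → + d ∣ x
  ≡0-mod⇒∣ {d} {x} (congruent h) = subst (+ d ∣_) (ℤ.+-identityʳ x) h

  ∣⇒≡0-mod : ∀ {d x} → + d ∣ x → x ≡ 0ℤ mod d
  ∣⇒≡0-mod {d} {x} h = congruent (subst (+ d ∣_) (sym (ℤ.+-identityʳ x)) h)

  module _ {p : ℕ} (p-prime : Prime p) where

    euclid-mod : ∀ {x y} → x * y ≡ 0ℤ mod p → x ≡ 0ℤ mod p ⊎ y ≡ 0ℤ mod p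
    euclid-mod {x} {y} h with euclidsLemma ∣ x ∣ ∣ y ∣ p-prime (subst (p ℕ.∣_) (ℤ.abs-* x y) (∣⇒∣ᵤ (≡0-mod⇒∣ h)))
    ... | inj₁ p∣x = inj₁ (∣⇒≡0-mod (∣ᵤ⇒∣ p∣x))
    ... | inj₂ p∣y = inj₂ (∣⇒≡0-mod (∣ᵤ⇒∣ p∣y))

    *-cancelʳ-mod : ∀ {x y z} → ¬ z ≡ 0ℤ mod p → x * z ≡ y * z mod p → x ≡ y mod p
    *-cancelʳ-mod {x} {y} {z} z≢0 h with euclid-mod (≡-mod-trans (≡⇒≡-mod ([x-y]*z≡x*z-y*z x y z)) (m≡n⇒m-n≡0-mod h))
      where [x-y]*z≡x*z-y*z : ∀ x y z → (x - y) * z ≡ x * z - y * z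
            [x-y]*z≡x*z-y*z = solve-∀
    ... | inj₁ x-y≡0 = m-n≡0⇒m≡n-mod x-y≡0
    ... | inj₂ z≡0   = contradiction z≡0 z≢0

    -- Opaque: conversion checking would otherwise unfold the Bézout computation behind the witness.
    opaque
      inverse-mod : ∀ {x} → ¬ x ≡ 0ℤ mod p → ∃ λ y → x * y ≡ 1ℤ mod p
      inverse-mod {x} x≢0 = map₂ (≡-mod-trans (*-cong-mod (≡-mod-sym (%ℕ-mod {{p≢0}} x)) ≡-mod-refl))
        (residue-inverse (coprime-Bézout (prime⇒coprime p-prime {{r≢0}} (n%ℕd<d x p {{p≢0}}))))
        where
        p≢0 : NonZero p
        p≢0 = prime⇒nonZero p-prime
        r : ℕ
        r = _%ℕ_ x p {{p≢0}}
        open ≡-mod-Reasoning p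
        r≢0 : NonZero r
        r≢0 = ℕ.≢-nonZero (λ r≡0 → x≢0 (≡-mod-trans (≡-mod-sym (%ℕ-mod {{p≢0}} x)) (≡⇒≡-mod (cong +_ r≡0))))
        pos-1+m*n : ∀ a b → + (1 ℕ.+ a ℕ.* b) ≡ 1ℤ + + a * + b
        pos-1+m*n a b = trans (ℤ.pos-+ 1 (a ℕ.* b)) (cong (_+_ 1ℤ) (ℤ.pos-* a b))
        r*[-b]≡1-[1+b*r] : ∀ r b → r * - b ≡ 1ℤ - (1ℤ + b * r)
        r*[-b]≡1-[1+b*r] = solve-∀
        1-a*p≡1+[-a]*p : ∀ a p → 1ℤ - a * p ≡ 1ℤ + (- a) * p
        1-a*p≡1+[-a]*p = solve-∀
        residue-inverse : Bézout.Identity 1 p r → ∃ λ y → + r * y ≡ 1ℤ mod p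
        residue-inverse (Bézout.+- a b 1+br≡ap) = - + b , (begin
          + r * - + b              ≡⟨ r*[-b]≡1-[1+b*r] (+ r) (+ b) ⟩
          1ℤ - (1ℤ + + b * + r)    ≡⟨ cong (λ z → 1ℤ - z) (trans (sym (pos-1+m*n b r)) (trans (cong +_ 1+br≡ap) (ℤ.pos-* a p))) ⟩
          1ℤ - + a * + p           ≡⟨ 1-a*p≡1+[-a]*p (+ a) (+ p) ⟩
          1ℤ + (- + a) * + p       ≈⟨ +-multiple-mod 1ℤ (- + a) ⟩
          1ℤ                       ∎)
        residue-inverse (Bézout.-+ a b 1+ap≡br) = + b , (begin
          + r * + b                ≡⟨ trans (ℤ.*-comm (+ r) (+ b)) (sym (ℤ.pos-* b r)) ⟩
          + (b ℕ.* r)              ≡⟨ cong +_ 1+ap≡br ⟨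
          + (1 ℕ.+ a ℕ.* p)        ≡⟨ pos-1+m*n a p ⟩
          1ℤ + + a * + p           ≈⟨ +-multiple-mod 1ℤ (+ a) ⟩
          1ℤ                       ∎)

  modN≡% : ∀ x d .{{_ : NonZero d}} → x modN d ≡ x % d
  modN≡% x (suc d) = refl

  modℤ≡%ℕ : ∀ z d .{{_ : NonZero d}} → z modℤ d ≡ z %ℕ d
  modℤ≡%ℕ z (suc d) = refl

  modℤ< : ∀ z d .{{_ : NonZero d}} → z modℤ d < d
  modℤ< z (suc d) = n%ℕd<d z (suc d)

  modℤ-mod : ∀ z d .{{_ : NonZero d}} → + (z modℤ d) ≡ z mod d
  modℤ-mod z (suc d) = %ℕ-mod z

  divℤ≡/ℕ : ∀ z d .{{_ : NonZero d}} → z divℤ d ≡ z /ℕ d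
  divℤ≡/ℕ z (suc d) = refl

module Polynomial where

  open Congruence
  open import Data.Nat.Base using (suc)
  open import Data.Integer.Base using (ℤ; +_; 0ℤ; _+_; _*_)
  import Data.Integer.Properties as ℤ
  open import Data.Integer.Divisibility.Signed using (_∣_; ∣m⇒∣m*n)
  open import Data.Integer.Tactic.RingSolver using (solve-∀)
  open import Data.List.Base using ([]; _∷_)
  open import Data.Product using (∃; _,_)
  open import Relation.Binary.PropositionalEquality using (_≡_; refl; sym; trans; cong; cong₂; module ≡-Reasoning)

  eval-cong-mod : ∀ f {d x y} → x ≡ y mod d → eval f x ≡ eval f y mod d
  eval-cong-mod []       h = ≡-mod-refl
  eval-cong-mod (b ∷ bs) h = +-congˡ-mod b (*-cong-mod h (eval-cong-mod bs h))

  eval-derivFrom-suc : ∀ i bs y → eval (derivFrom (suc i) bs) y ≡ eval (derivFrom i bs) y + eval bs y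
  eval-derivFrom-suc i []       y = refl
  eval-derivFrom-suc i (b ∷ bs) y = begin
    + (suc i) * b + y * eval (derivFrom (suc (suc i)) bs) y
      ≡⟨ cong₂ (λ u v → u * b + y * v) (ℤ.pos-+ 1 i) (eval-derivFrom-suc (suc i) bs y) ⟩
    (+ 1 + + i) * b + y * (eval (derivFrom (suc i) bs) y + eval bs y)
      ≡⟨ regroup (+ i) b y (eval (derivFrom (suc i) bs) y) (eval bs y) ⟩
    (+ i * b + y * eval (derivFrom (suc i) bs) y) + (b + y * eval bs y)
      ∎
    where
    open ≡-Reasoning
    regroup : ∀ i b y u v → (+ 1 + i) * b + y * (u + v) ≡ (i * b + y * u) + (b + y * v)
    regroup = solve-∀

  eval-derivFrom-0 : ∀ bs y → eval (derivFrom 0 bs) y ≡ y * eval (deriv bs) y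
  eval-derivFrom-0 []       y = sym (ℤ.*-zeroʳ y)
  eval-derivFrom-0 (b ∷ bs) y =
    trans (cong (_+ y * eval (derivFrom 1 bs) y) (ℤ.*-zeroˡ b)) (ℤ.+-identityˡ _)

  eval-deriv-∷ : ∀ b bs y → eval (deriv (b ∷ bs)) y ≡ y * eval (deriv bs) y + eval bs y
  eval-deriv-∷ b bs y = trans (eval-derivFrom-suc 0 bs y) (cong (_+ eval bs y) (eval-derivFrom-0 bs y))

  taylor : ∀ f y h → ∃ λ q → eval f (y + h) ≡ eval f y + h * eval (deriv f) y + h * h * q
  taylor []       y h = 0ℤ , zero-case h
    where
    zero-case : ∀ h → 0ℤ ≡ 0ℤ + h * 0ℤ + h * h * 0ℤ
    zero-case = solve-∀
  taylor (b ∷ bs) y h with taylor bs y h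
  ... | q , eq = eval (deriv bs) y + (y + h) * q , (begin
    b + (y + h) * eval bs (y + h)
      ≡⟨ cong (λ u → b + (y + h) * u) eq ⟩
    b + (y + h) * (eval bs y + h * eval (deriv bs) y + h * h * q)
      ≡⟨ expand b y h (eval bs y) (eval (deriv bs) y) q ⟩
    (b + y * eval bs y) + h * (y * eval (deriv bs) y + eval bs y) + h * h * (eval (deriv bs) y + (y + h) * q)
      ≡⟨ cong (λ u → (b + y * eval bs y) + h * u + h * h * (eval (deriv bs) y + (y + h) * q)) (sym (eval-deriv-∷ b bs y)) ⟩
    (b + y * eval bs y) + h * eval (deriv (b ∷ bs)) y + h * h * (eval (deriv bs) y + (y + h) * q)
      ∎)
    where
    open ≡-Reasoning
    expand : ∀ b y h g g' q → b + (y + h) * (g + h * g' + h * h * q) ≡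
             (b + y * g) + h * (y * g' + g) + h * h * (g' + (y + h) * q)
    expand = solve-∀

  taylor-mod : ∀ f y h {d} → + d ∣ h * h → eval f (y + h) ≡ eval f y + h * eval (deriv f) y mod d
  taylor-mod f y h {d} d∣h² with taylor f y h
  ... | q , eq = begin
    eval f (y + h)                                 ≡⟨ eq ⟩
    eval f y + h * eval (deriv f) y + h * h * q    ≈⟨ +-congˡ-mod (eval f y + h * eval (deriv f) y) (∣⇒≡0-mod (∣m⇒∣m*n q d∣h²)) ⟩
    eval f y + h * eval (deriv f) y + 0ℤ           ≡⟨ ℤ.+-identityʳ _ ⟩
    eval f y + h * eval (deriv f) y                ∎
    where open ≡-mod-Reasoning d

module FunctionalGraph where

  open import Data.Nat.Base as ℕ using (ℕ; zero; suc; _<_; _≤_; _∸_; _%_; _/_; NonZero; >-nonZero; s≤s; z≤n)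
  open import Data.Nat.Properties
    using (+-comm; +-assoc; *-comm; <-cmp; <⇒≤; m∸n+n≡m; m<n⇒0<n∸m; m≤m+n; +-monoʳ-<; <-≤-trans; ≤-reflexive; m≤m*n; suc-pred)
  open import Data.Nat.DivMod using (m≡m%n+[m/n]*n; m%n<n; m<n⇒m%n≡m; [m+n]%n≡m%n; [m+kn]%n≡m%n; m%n%n≡m%n; %-distribˡ-+)
  open import Data.Integer.Base using (+_)
  open import Data.Integer.DivMod using (n%ℕd<d)
  open import Data.Fin.Base using (Fin; toℕ; fromℕ<)
  open import Data.Fin.Properties using (toℕ-fromℕ<; toℕ-injective; toℕ<n)
  open import Data.Product using (∃; ∃₂; _×_; _,_)
  open import Function.Base using (_∘_)
  open import Function.Bundles using (mk⇔)
  open import Relation.Binary.Definitions using (tri<; tri≈; tri>)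
  open import Relation.Binary.PropositionalEquality
    using (_≡_; _≢_; refl; sym; trans; cong; subst; module ≡-Reasoning)
  open import Relation.Nullary using (contradiction)

  module _ {A : Set} (g : A → A) where

    iter-+ : ∀ m n x → iter g (m ℕ.+ n) x ≡ iter g m (iter g n x)
    iter-+ zero    n x = refl
    iter-+ (suc m) n x = cong g (iter-+ m n x)

    iter-sucʳ : ∀ n x → iter g (suc n) x ≡ iter g n (g x)
    iter-sucʳ n x = trans (cong (λ m → iter g m x) (+-comm 1 n)) (iter-+ n 1 x)

    iter-*-periodic : ∀ {d x} → iter g d x ≡ x → ∀ q → iter g (q ℕ.* d) x ≡ x
    iter-*-periodic         per zero    = refl
    iter-*-periodic {d} {x} per (suc q) =
      trans (iter-+ d (q ℕ.* d) x) (trans (cong (iter g d) (iter-*-periodic per q)) per)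

    iter-%-periodic : ∀ {d x} .{{_ : NonZero d}} → iter g d x ≡ x → ∀ j → iter g j x ≡ iter g (j % d) x
    iter-%-periodic {d} {x} per j = begin
      iter g j x                                  ≡⟨ cong (λ m → iter g m x) (m≡m%n+[m/n]*n j d) ⟩
      iter g (j % d ℕ.+ (j / d) ℕ.* d) x          ≡⟨ iter-+ (j % d) _ x ⟩
      iter g (j % d) (iter g ((j / d) ℕ.* d) x)   ≡⟨ cong (iter g (j % d)) (iter-*-periodic per (j / d)) ⟩
      iter g (j % d) x                            ∎
      where open ≡-Reasoning

    iter-∸-periodic : ∀ {e x} j → j ≤ e → iter g e x ≡ x → iter g (e ∸ j) (iter g j x) ≡ x
    iter-∸-periodic {e} {x} j j≤e per =
      trans (sym (iter-+ (e ∸ j) j x)) (trans (cong (λ m → iter g m x) (m∸n+n≡m j≤e)) per)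

    iter-return : ∀ {d x y} e .{{_ : NonZero d}} → iter g d x ≡ x → iter g e x ≡ y → iter g (e ℕ.* d ∸ e) y ≡ x
    iter-return {d} e per refl = iter-∸-periodic e (m≤m*n e d) (iter-*-periodic per e)

    iter-fixed : ∀ {x} → g x ≡ x → ∀ e → iter g e x ≡ x
    iter-fixed gx≡x zero    = refl
    iter-fixed gx≡x (suc e) = trans (cong g (iter-fixed gx≡x e)) gx≡x

    record ExactPeriod (d : ℕ) (x : A) : Set where
      field
        positive : 0 < d
        periodic : iter g d x ≡ x
        minimal  : ∀ j → 0 < j → j < d → iter g j x ≢ x

    exactPeriod-fixed : ∀ {x} → g x ≡ x → ExactPeriod 1 x
    exactPeriod-fixed gx≡x = record
      { positive = s≤s z≤n
      ; periodic = gx≡x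
      ; minimal  = λ { (suc j) _ (s≤s ()) }
      }

    module _ {d x} (ep : ExactPeriod d x) where
      open ExactPeriod ep

      private
        distinct-iterates : ∀ {i j} → i < j → j < d → iter g i x ≢ iter g j x
        distinct-iterates {i} {j} i<j j<d eq = minimal (d ∸ j ℕ.+ i) 0<d∸j+i d∸j+i<d (begin
          iter g (d ∸ j ℕ.+ i) x          ≡⟨ iter-+ (d ∸ j) i x ⟩
          iter g (d ∸ j) (iter g i x)     ≡⟨ cong (iter g (d ∸ j)) eq ⟩
          iter g (d ∸ j) (iter g j x)     ≡⟨ iter-∸-periodic j (<⇒≤ j<d) periodic ⟩
          x                               ∎)
          where
          open ≡-Reasoning
          0<d∸j+i : 0 < d ∸ j ℕ.+ i
          0<d∸j+i = <-≤-trans (m<n⇒0<n∸m j<d) (m≤m+n _ i)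
          d∸j+i<d : d ∸ j ℕ.+ i < d
          d∸j+i<d = <-≤-trans (+-monoʳ-< (d ∸ j) i<j) (≤-reflexive (m∸n+n≡m (<⇒≤ j<d)))

      exactPeriod-injective : ∀ {i j} → i < d → j < d → iter g i x ≡ iter g j x → i ≡ j
      exactPeriod-injective {i} {j} i<d j<d eq with <-cmp i j
      ... | tri< i<j _ _ = contradiction eq (distinct-iterates i<j j<d)
      ... | tri≈ _ i≡j _ = i≡j
      ... | tri> _ _ j<i = contradiction (sym eq) (distinct-iterates j<i i<d)

  toℕ-next : ∀ {k} .{{_ : NonZero k}} (i : Fin k) → toℕ (next i) ≡ suc (toℕ i) % k
  toℕ-next {suc k} i = toℕ-fromℕ< _

  module CycleVertices {f : Poly} {L k : ℕ} (D : Cycle f L k) where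

    private
      instance
        k≢0 : NonZero k
        k≢0 = >-nonZero (size>0 D)

      F : ℕ → ℕ
      F = fmap f L

      [1+m%n]%n≡[1+m]%n : ∀ m n .{{_ : NonZero n}} → suc (m % n) % n ≡ suc m % n
      [1+m%n]%n≡[1+m]%n m n = begin
        (1 ℕ.+ m % n) % n             ≡⟨ %-distribˡ-+ 1 (m % n) n ⟩
        (1 % n ℕ.+ m % n % n) % n     ≡⟨ cong (λ r → (1 % n ℕ.+ r) % n) (m%n%n≡m%n m n) ⟩
        (1 % n ℕ.+ m % n) % n         ≡⟨ %-distribˡ-+ 1 m n ⟨
        (1 ℕ.+ m) % n                 ∎
        where open ≡-Reasoning

    vertex : ℕ → ℕ
    vertex j = vert D (fromℕ< (m%n<n j k))

    vertex-cong-% : ∀ {i j} → i % k ≡ j % k → vertex i ≡ vertex j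
    vertex-cong-% eq = cong (vert D) (toℕ-injective (trans (toℕ-fromℕ< _) (trans eq (sym (toℕ-fromℕ< _)))))

    vertex-injective : ∀ {i j} → vertex i ≡ vertex j → i % k ≡ j % k
    vertex-injective eq = trans (sym (toℕ-fromℕ< _)) (trans (cong toℕ (inj D eq)) (toℕ-fromℕ< _))

    vertex-toℕ : ∀ i → vertex (toℕ i) ≡ vert D i
    vertex-toℕ i = cong (vert D) (toℕ-injective (trans (toℕ-fromℕ< _) (m<n⇒m%n≡m (toℕ<n i))))

    vertex-+k : ∀ s → vertex (k ℕ.+ s) ≡ vertex s
    vertex-+k s = vertex-cong-% (trans (cong (_% k) (+-comm k s)) ([m+n]%n≡m%n s k))

    fmap-vertex : ∀ j → F (vertex j) ≡ vertex (suc j)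
    fmap-vertex j = trans (step D _) (cong (vert D) (toℕ-injective (begin
      toℕ (next (fromℕ< (m%n<n j k)))        ≡⟨ toℕ-next _ ⟩
      suc (toℕ (fromℕ< (m%n<n j k))) % k     ≡⟨ cong (λ r → suc r % k) (toℕ-fromℕ< _) ⟩
      suc (j % k) % k                        ≡⟨ [1+m%n]%n≡[1+m]%n j k ⟩
      suc j % k                              ≡⟨ toℕ-fromℕ< _ ⟨
      toℕ (fromℕ< (m%n<n (suc j) k))         ∎)))
      where open ≡-Reasoning

    iter-vertex : ∀ j s → iter F j (vertex s) ≡ vertex (j ℕ.+ s)
    iter-vertex zero    s = refl
    iter-vertex (suc j) s = trans (cong F (iter-vertex j s)) (fmap-vertex (j ℕ.+ s))

    ∈C⇒vertex : ∀ {x} → x ∈C D → ∃ λ j → vertex j ≡ x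
    ∈C⇒vertex (i , refl) = toℕ i , vertex-toℕ i

    vertex-∈C : ∀ j → vertex j ∈C D
    vertex-∈C j = fromℕ< (m%n<n j k) , refl

    iter-∈C : ∀ {x} j → x ∈C D → iter F j x ∈C D
    iter-∈C j x∈D with ∈C⇒vertex x∈D
    ... | s , refl = subst (_∈C D) (sym (iter-vertex j s)) (vertex-∈C (j ℕ.+ s))

    ∈C-periodic : ∀ {x} → x ∈C D → iter F k x ≡ x
    ∈C-periodic x∈D with ∈C⇒vertex x∈D
    ... | s , refl = trans (iter-vertex k s) (vertex-+k s)

    ∈C-reachable : ∀ {x y} → x ∈C D → y ∈C D → ∃ λ j → iter F j x ≡ y
    ∈C-reachable x∈D y∈D with ∈C⇒vertex x∈D | ∈C⇒vertex y∈D
    ... | s , refl | t , refl = t ℕ.+ ℕ.pred k ℕ.* s , trans (iter-vertex _ s) (vertex-cong-% (begin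
      (t ℕ.+ ℕ.pred k ℕ.* s ℕ.+ s) % k     ≡⟨ cong (_% k) (+-assoc t _ s) ⟩
      (t ℕ.+ (ℕ.pred k ℕ.* s ℕ.+ s)) % k   ≡⟨ cong (λ m → (t ℕ.+ m) % k) pred[k]*s+s≡s*k ⟩
      (t ℕ.+ s ℕ.* k) % k                 ≡⟨ [m+kn]%n≡m%n t s k ⟩
      t % k                               ∎))
      where
      open ≡-Reasoning
      pred[k]*s+s≡s*k : ℕ.pred k ℕ.* s ℕ.+ s ≡ s ℕ.* k
      pred[k]*s+s≡s*k = trans (+-comm _ s) (trans (cong (ℕ._* s) (suc-pred k)) (*-comm k s))

    periodic-∈C : ∀ {x e} j .{{_ : NonZero e}} → iter F e x ≡ x → iter F j x ∈C D → x ∈C D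
    periodic-∈C {e = e} j per fʲx∈D = subst (_∈C D) (iter-return F j per refl) (iter-∈C (j ℕ.* e ∸ j) fʲx∈D)

  open CycleVertices public

  shared-vertex⇒SameCycle : ∀ {f L k k'} (D : Cycle f L k) (E : Cycle f L k') {x} →
                            x ∈C D → x ∈C E → SameCycle D E
  shared-vertex⇒SameCycle D E x∈D x∈E y = mk⇔
    (λ y∈D → let j , eq = ∈C-reachable D x∈D y∈D in subst (_∈C E) eq (iter-∈C E j x∈E))
    (λ y∈E → let j , eq = ∈C-reachable E x∈E y∈E in subst (_∈C D) eq (iter-∈C D j x∈D))

  fmap< : ∀ f L .{{_ : NonZero L}} x → fmap f L x < L
  fmap< f (suc L) x = n%ℕd<d (eval f (+ x)) (suc L)

  iter-fmap< : ∀ f {L x} .{{_ : NonZero L}} → x < L → ∀ j → iter (fmap f L) j x < L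
  iter-fmap< f x<L zero    = x<L
  iter-fmap< f x<L (suc j) = fmap< f _ _

  module _ {f : Poly} {L : ℕ} .{{_ : NonZero L}} where

    private
      F : ℕ → ℕ
      F = fmap f L

    cycleThrough : ∀ {d x} → x < L → ExactPeriod F d x → Cycle f L d
    cycleThrough {d} {x} x<L ep = record
      { size>0 = positive
      ; vert   = λ i → iter F (toℕ i) x
      ; bound  = λ i → iter-fmap< f x<L (toℕ i)
      ; inj    = λ eq → toℕ-injective (exactPeriod-injective F ep (toℕ<n _) (toℕ<n _) eq)
      ; step   = λ i → trans (iter-%-periodic F {{d≢0}} periodic (suc (toℕ i))) (cong (λ j → iter F j x) (sym (toℕ-next {{d≢0}} i)))
      }
      where
      open ExactPeriod ep
      d≢0 : NonZero d
      d≢0 = >-nonZero positive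

    ∈-cycleThrough : ∀ {d x} (x<L : x < L) (ep : ExactPeriod F d x) → x ∈C cycleThrough x<L ep
    ∈-cycleThrough {x = x} x<L ep = fromℕ< (ExactPeriod.positive ep) , cong (λ j → iter F j x) (toℕ-fromℕ< (ExactPeriod.positive ep))

  record CycleDecomposition (g : ℕ → ℕ) (n t : ℕ) (size : Fin t → ℕ) : Set where
    field
      point       : Fin t → ℕ
      point<      : ∀ j → point j < n
      exactPeriod : ∀ j → ExactPeriod g (size j) (point j)
      disjoint    : ∀ {j j'} e → iter g e (point j) ≡ point j' → j ≡ j'
      covering    : ∀ {y} → y < n → ∃₂ λ j e → iter g e (point j) ≡ y

  module _ {g g' h : ℕ → ℕ} {n : ℕ}
    (g<     : ∀ {x} → x < n → g x < n)
    (h<     : ∀ {x} → x < n → h x < n)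
    (h-inj  : ∀ {x y} → x < n → y < n → h x ≡ h y → x ≡ y)
    (h-onto : ∀ {y} → y < n → ∃ λ x → x < n × h x ≡ y)
    (g'∘h≡h∘g : ∀ {x} → x < n → g' (h x) ≡ h (g x))
    where

    private
      iter-g< : ∀ {x} → x < n → ∀ e → iter g e x < n
      iter-g< x<n zero    = x<n
      iter-g< x<n (suc e) = g< (iter-g< x<n e)

      iter-conjugate : ∀ {x} → x < n → ∀ e → iter g' e (h x) ≡ h (iter g e x)
      iter-conjugate x<n zero    = refl
      iter-conjugate x<n (suc e) = trans (cong g' (iter-conjugate x<n e)) (g'∘h≡h∘g (iter-g< x<n e))

    conjugate-decomposition : ∀ {t size} → CycleDecomposition g n t size → CycleDecomposition g' n t size
    conjugate-decomposition {t} {size} cd = record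
      { point       = h ∘ point
      ; point<      = λ j → h< (point< j)
      ; exactPeriod = λ j → conjugate-exactPeriod (point< j) (exactPeriod j)
      ; disjoint    = λ {j} {j'} e eq → disjoint e (h-inj (iter-g< (point< j) e) (point< j')
                        (trans (sym (iter-conjugate (point< j) e)) eq))
      ; covering    = conjugate-covering
      }
      where
      open CycleDecomposition cd
      conjugate-exactPeriod : ∀ {d x} → x < n → ExactPeriod g d x → ExactPeriod g' d (h x)
      conjugate-exactPeriod {d} x<n ep = record
        { positive = positive
        ; periodic = trans (iter-conjugate x<n d) (cong h periodic)
        ; minimal  = λ j 0<j j<d eq → minimal j 0<j j<d
                       (h-inj (iter-g< x<n j) x<n (trans (sym (iter-conjugate x<n j)) eq))
        }
        where open ExactPeriod ep
      conjugate-covering : ∀ {y} → y < n → ∃₂ λ j e → iter g' e (h (point j)) ≡ y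
      conjugate-covering y<n with h-onto y<n
      ... | x , x<n , refl with covering x<n
      ...   | j , e , refl = j , e , iter-conjugate (point< j) e

module Affine where

  open Congruence
  open FunctionalGraph
  open import Data.Nat.Base as ℕ using (ℕ; zero; suc; _<_; _%_; NonZero; >-nonZero⁻¹)
  open import Data.Nat.Properties using (<⇒≢)
  open import Data.Nat.DivMod using (m%n<n)
  open import Data.Nat.Primality using (Prime)
  open import Data.Integer.Base using (ℤ; +_; 0ℤ; 1ℤ; _+_; _*_; -_; _-_; _%ℕ_)
  import Data.Integer.Properties as ℤ
  open import Data.Integer.Tactic.RingSolver using (solve-∀)
  open import Data.Fin.Base as Fin using (Fin; toℕ; fromℕ<)
  open import Data.Fin.Properties using (toℕ<n; toℕ-injective; toℕ-fromℕ<)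
  open import Data.Product using (∃; _,_; proj₁; proj₂)
  open import Data.Sum using (inj₁; inj₂)
  open import Relation.Nullary using (¬_)
  open import Relation.Binary.PropositionalEquality
    using (_≡_; _≢_; refl; sym; trans; cong; cong₂; module ≡-Reasoning)

  pos-+-* : ∀ b a t → + (b ℕ.+ a ℕ.* t) ≡ + b + + a * + t
  pos-+-* b a t = trans (ℤ.pos-+ b (a ℕ.* t)) (cong (_+_ (+ b)) (ℤ.pos-* a t))

  module AffineMap (p : ℕ) .{{_ : NonZero p}} (b a : ℕ) where

    affine : ℕ → ℕ
    affine t = (b ℕ.+ a ℕ.* t) % p

    affine< : ∀ t → affine t < p
    affine< t = m%n<n _ p

    iter-affine< : ∀ {t} → t < p → ∀ e → iter affine e t < p
    iter-affine< t<p zero    = t<p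
    iter-affine< t<p (suc e) = affine< _

    affine-≡-mod : ∀ t → + affine t ≡ + b + + a * + t mod p
    affine-≡-mod t = ≡-mod-trans (%ℕ-mod (+ (b ℕ.+ a ℕ.* t))) (≡⇒≡-mod (pos-+-* b a t))

    affine-≡ : ∀ {t u} → u < p → + b + + a * + t ≡ + u mod p → affine t ≡ u
    affine-≡ {t} u<p h = residue-unique (affine< t) u<p (≡-mod-trans (affine-≡-mod t) h)

    affine-constant : a ≡ 0 → ∀ t → affine t ≡ affine 0
    affine-constant refl t = refl

    iter-affine-conjugate : ∀ {t*} → + b + + a * + t* ≡ + t* mod p →
                            ∀ e {y w} → + y ≡ + t* + w mod p → + iter affine e y ≡ + t* + + (a ℕ.^ e) * w mod p
    iter-affine-conjugate {t*} fixed zero {y} {w} h = ≡-mod-trans h (≡⇒≡-mod (cong (_+_ (+ t*)) (sym (ℤ.*-identityˡ w))))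
    iter-affine-conjugate {t*} fixed (suc e) {y} {w} h = begin
      + affine (iter affine e y)                            ≈⟨ affine-≡-mod _ ⟩
      + b + + a * + iter affine e y                         ≈⟨ +-congˡ-mod (+ b) (*-congˡ-mod (+ a) (iter-affine-conjugate fixed e h)) ⟩
      + b + + a * (+ t* + + (a ℕ.^ e) * w)                  ≡⟨ regroup (+ b) (+ a) (+ t*) (+ (a ℕ.^ e)) w ⟩
      (+ b + + a * + t*) + + a * + (a ℕ.^ e) * w            ≈⟨ +-congʳ-mod (+ a * + (a ℕ.^ e) * w) fixed ⟩
      + t* + + a * + (a ℕ.^ e) * w                          ≡⟨ cong (λ c → + t* + c * w) (ℤ.pos-* a (a ℕ.^ e)) ⟨
      + t* + + (a ℕ.^ suc e) * w                            ∎
      where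
      open ≡-mod-Reasoning p
      regroup : ∀ b a t c w → b + a * (t + c * w) ≡ (b + a * t) + a * c * w
      regroup = solve-∀

    module _ (a≡1 : a ≡ 1) where

      iter-translation : ∀ e t → + iter affine e t ≡ + t + + e * + b mod p
      iter-translation zero    t = ≡⇒≡-mod (sym (trans (cong (_+_ (+ t)) (ℤ.*-zeroˡ (+ b))) (ℤ.+-identityʳ (+ t))))
      iter-translation (suc e) t = begin
        + affine (iter affine e t)               ≈⟨ affine-≡-mod _ ⟩
        + b + + a * + iter affine e t            ≡⟨ cong (λ c → + b + + c * + iter affine e t) a≡1 ⟩
        + b + + 1 * + iter affine e t            ≈⟨ +-congˡ-mod (+ b) (*-congˡ-mod (+ 1) (iter-translation e t)) ⟩
        + b + + 1 * (+ t + + e * + b)            ≡⟨ regroup (+ b) (+ t) (+ e) ⟩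
        + t + (+ 1 + + e) * + b                  ≡⟨ cong (λ c → + t + c * + b) (ℤ.pos-+ 1 e) ⟨
        + t + + suc e * + b                      ∎
        where
        open ≡-mod-Reasoning p
        regroup : ∀ b t e → b + + 1 * (t + e * b) ≡ t + (+ 1 + e) * b
        regroup = solve-∀

      translation-periodic : ∀ {t} → t < p → iter affine p t ≡ t
      translation-periodic {t} t<p = residue-unique (iter-affine< t<p p) t<p (begin
        + iter affine p t     ≈⟨ iter-translation p t ⟩
        + t + + p * + b       ≡⟨ cong (_+_ (+ t)) (ℤ.*-comm (+ p) (+ b)) ⟩
        + t + + b * + p       ≈⟨ +-multiple-mod (+ t) (+ b) ⟩
        + t                   ∎)
        where open ≡-mod-Reasoning p

      identity-decomposition : b ≡ 0 → CycleDecomposition affine p p (λ _ → 1)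
      identity-decomposition b≡0 = record
        { point       = toℕ
        ; point<      = toℕ<n
        ; exactPeriod = λ j → exactPeriod-fixed affine (affine-identity (toℕ<n j))
        ; disjoint    = λ {j} e eq → toℕ-injective (trans (sym (iter-fixed affine (affine-identity (toℕ<n j)) e)) eq)
        ; covering    = λ y<p → fromℕ< y<p , 0 , toℕ-fromℕ< y<p
        }
        where
        affine-identity : ∀ {t} → t < p → affine t ≡ t
        affine-identity {t} t<p = affine-≡ t<p (≡⇒≡-mod (begin
          + b + + a * + t    ≡⟨ cong₂ (λ c d → + c + + d * + t) b≡0 a≡1 ⟩
          + 0 + + 1 * + t    ≡⟨ ℤ.+-identityˡ (+ 1 * + t) ⟩
          + 1 * + t          ≡⟨ ℤ.*-identityˡ (+ t) ⟩
          + t                ∎))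
          where open ≡-Reasoning

      translation-decomposition : Prime p → ¬ + b ≡ 0ℤ mod p → CycleDecomposition affine p 1 (λ _ → p)
      translation-decomposition p-prime b≢0 = record
        { point       = λ _ → 0
        ; point<      = λ _ → 0<p
        ; exactPeriod = λ _ → record
            { positive = 0<p
            ; periodic = translation-periodic 0<p
            ; minimal  = no-early-return
            }
        ; disjoint    = λ { {Fin.zero} {Fin.zero} _ _ → refl }
        ; covering    = covering
        }
        where
        0<p : 0 < p
        0<p = >-nonZero⁻¹ p
        iter-from-0 : ∀ e → + iter affine e 0 ≡ + e * + b mod p
        iter-from-0 e = ≡-mod-trans (iter-translation e 0) (≡⇒≡-mod (ℤ.+-identityˡ (+ e * + b)))
        no-early-return : ∀ j → 0 < j → j < p → iter affine j 0 ≢ 0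
        no-early-return j 0<j j<p eq with euclid-mod p-prime (≡-mod-trans (≡-mod-sym (iter-from-0 j)) (≡⇒≡-mod (cong +_ eq)))
        ... | inj₁ j≡0 = <⇒≢ 0<j (sym (residue-unique j<p 0<p j≡0))
        ... | inj₂ b≡0 = b≢0 b≡0
        covering : ∀ {y} → y < p → ∃ λ j → ∃ λ e → iter affine e 0 ≡ y
        covering {y} y<p with inverse-mod p-prime b≢0
        ... | b⁻¹ , b*b⁻¹≡1 = Fin.zero , e , residue-unique (iter-affine< 0<p e) y<p (begin
          + iter affine e 0           ≈⟨ iter-from-0 e ⟩
          + e * + b                   ≈⟨ *-congʳ-mod (+ b) (%ℕ-mod (+ y * b⁻¹)) ⟩
          + y * b⁻¹ * + b             ≡⟨ ℤ.*-assoc (+ y) b⁻¹ (+ b) ⟩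
          + y * (b⁻¹ * + b)           ≡⟨ cong (_*_ (+ y)) (ℤ.*-comm b⁻¹ (+ b)) ⟩
          + y * (+ b * b⁻¹)           ≈⟨ *-congˡ-mod (+ y) b*b⁻¹≡1 ⟩
          + y * 1ℤ                    ≡⟨ ℤ.*-identityʳ (+ y) ⟩
          + y                         ∎)
          where
          open ≡-mod-Reasoning p
          e = (+ y * b⁻¹) %ℕ p

    module _ (p-prime : Prime p) (a≢1 : ¬ + a ≡ 1ℤ mod p) where

      private
        1-a⁻¹ : ∃ λ i → (1ℤ - + a) * i ≡ 1ℤ mod p
        1-a⁻¹ = inverse-mod p-prime (λ 1-a≡0 → a≢1 (≡-mod-sym (m-n≡0⇒m≡n-mod 1-a≡0)))

      fixedPoint : ℕ
      fixedPoint = (+ b * proj₁ 1-a⁻¹) %ℕ p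

      fixedPoint-fixed : + b + + a * + fixedPoint ≡ + fixedPoint mod p
      fixedPoint-fixed = begin
        + b + + a * T                  ≈⟨ +-congʳ-mod (+ a * T) b≡[1-a]T ⟩
        (1ℤ - + a) * T + + a * T       ≡⟨ cancel (+ a) T ⟩
        T                              ∎
        where
        open ≡-mod-Reasoning p
        i = proj₁ 1-a⁻¹
        T = + fixedPoint
        cancel : ∀ a t → (1ℤ - a) * t + a * t ≡ t
        cancel = solve-∀
        swap : ∀ b c i → b * (c * i) ≡ c * (b * i)
        swap = solve-∀
        b≡[1-a]T : + b ≡ (1ℤ - + a) * T mod p
        b≡[1-a]T = begin
          + b                          ≡⟨ ℤ.*-identityʳ (+ b) ⟨
          + b * 1ℤ                     ≈⟨ *-congˡ-mod (+ b) (≡-mod-sym (proj₂ 1-a⁻¹)) ⟩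
          + b * ((1ℤ - + a) * i)       ≡⟨ swap (+ b) (1ℤ - + a) i ⟩
          (1ℤ - + a) * (+ b * i)       ≈⟨ *-congˡ-mod (1ℤ - + a) (≡-mod-sym (%ℕ-mod (+ b * i))) ⟩
          (1ℤ - + a) * T               ∎

      affine-order-periodic : ∀ {m} → + (a ℕ.^ m) ≡ 1ℤ mod p → ∀ {t} → t < p → iter affine m t ≡ t
      affine-order-periodic {m} a^m≡1 {t} t<p = residue-unique (iter-affine< t<p m) t<p (begin
        + iter affine m t                ≈⟨ iter-affine-conjugate fixedPoint-fixed m (≡⇒≡-mod (split (+ t) T)) ⟩
        T + + (a ℕ.^ m) * (+ t - T)      ≈⟨ +-congˡ-mod T (*-congʳ-mod (+ t - T) a^m≡1) ⟩
        T + 1ℤ * (+ t - T)               ≡⟨ unsplit (+ t) T ⟩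
        + t                              ∎)
        where
        open ≡-mod-Reasoning p
        T = + fixedPoint
        split : ∀ t c → t ≡ c + (t - c)
        split = solve-∀
        unsplit : ∀ t c → c + 1ℤ * (t - c) ≡ t
        unsplit = solve-∀

module Cosets where

  open Congruence
  open FunctionalGraph
  open Affine
  open import Data.Nat.Base as ℕ using (ℕ; zero; suc; _<_; _≤_; _∸_; _%_; _/_; _^_; NonZero; >-nonZero; s≤s; z≤n)
  open import Data.Nat.Properties using (_≤?_; _<?_; ≤-antisym; ≤-trans; ≤-reflexive; n≢0⇒n>0; <⇒≢; allUpTo?; module ≤-Reasoning)
  open import Data.Nat.DivMod using (m%n<n; m<n⇒m%n≡m; m*n/n≡m)
  open import Data.Nat.Primality using (Prime; prime⇒nonZero; prime⇒nonTrivial)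
  open import Data.Integer.Base using (ℤ; +_; 0ℤ; 1ℤ; _+_; _*_; -_; _-_; _%ℕ_)
  import Data.Integer.Properties as ℤ
  open import Data.Integer.DivMod using (n%ℕd<d)
  open import Data.Integer.Tactic.RingSolver using (solve-∀)
  open import Data.Fin.Base as Fin using (Fin; toℕ; fromℕ<; combine; remQuot)
  open import Data.Fin.Properties using (toℕ<n; toℕ-injective; toℕ-fromℕ<; injective⇒≤; combine-remQuot; remQuot-combine)
  open import Data.List.Base using (List; _∷_; lookup; length; filter; upTo)
  open import Data.List.Extrema.Nat using (argmin; f[argmin]≤f[xs])
  open import Data.List.Membership.Propositional using (_∈_)
  open import Data.List.Membership.Propositional.Properties using (∈-lookup; ∈-upTo⁺; ∈-upTo⁻; ∈-filter⁺; ∈-filter⁻)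
  import Data.List.Relation.Unary.All as All
  import Data.List.Relation.Unary.Any as Any
  open import Data.List.Relation.Unary.Any.Properties using (lookup-index)
  open import Data.List.Relation.Unary.AllPairs using (_∷_)
  open import Data.List.Relation.Unary.Unique.Propositional using (Unique)
  open import Data.List.Relation.Unary.Unique.Propositional.Properties using (upTo⁺; filter⁺)
  open import Data.Product using (∃; ∃₂; _×_; _,_; proj₁; proj₂; uncurry)
  open import Data.Product.Properties using (×-≡,≡→≡)
  open import Data.Sum using (inj₁; inj₂)
  open import Function.Base using (_∘_)
  open import Relation.Nullary using (¬_; Dec; contradiction)
  open import Relation.Nullary.Decidable using (_×-dec_)
  open import Relation.Binary.PropositionalEquality
    using (_≡_; _≢_; refl; sym; trans; cong; subst; module ≡-Reasoning)

  lookup-injective : ∀ {A : Set} {xs : List A} → Unique xs → ∀ {i j} → lookup xs i ≡ lookup xs j → i ≡ j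
  lookup-injective (x∉xs ∷ u) {Fin.zero}  {Fin.zero}  eq = refl
  lookup-injective (x∉xs ∷ u) {Fin.zero}  {Fin.suc j} eq = contradiction eq (All.lookup x∉xs (∈-lookup j))
  lookup-injective (x∉xs ∷ u) {Fin.suc i} {Fin.zero}  eq = contradiction (sym eq) (All.lookup x∉xs (∈-lookup i))
  lookup-injective (x∉xs ∷ u) {Fin.suc i} {Fin.suc j} eq = cong Fin.suc (lookup-injective u eq)

  enumeration-size : ∀ {n N} (φ : Fin n → ℕ) → (∀ i → φ i < N) → (∀ {i j} → φ i ≡ φ j → i ≡ j) →
                     (∀ {y} → y < N → ∃ λ i → φ i ≡ y) → n ≡ N
  enumeration-size φ φ< φ-inj φ-onto = ≤-antisym
    (injective⇒≤ {f = λ i → fromℕ< (φ< i)}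
      (λ eq → φ-inj (trans (sym (toℕ-fromℕ< _)) (trans (cong toℕ eq) (toℕ-fromℕ< _)))))
    (injective⇒≤ {f = λ y → proj₁ (φ-onto (toℕ<n y))}
      (λ eq → toℕ-injective (trans (sym (proj₂ (φ-onto _))) (trans (cong φ eq) (proj₂ (φ-onto _))))))

  module MultiplicativeOrbits (p : ℕ) (p-prime : Prime p) (a m : ℕ) (order : IsMultOrder p a m) where

    private
      instance
        p≢0 : NonZero p
        p≢0 = prime⇒nonZero p-prime
        m≢0 : NonZero m
        m≢0 = >-nonZero (proj₁ order)

      1<p : 1 < p
      1<p = ℕ.nonTrivial⇒n>1 p {{prime⇒nonTrivial p-prime}}

      0<p : 0 < p
      0<p = ℕ.>-nonZero⁻¹ p

    open AffineMap p 0 a using () renaming (affine to μ; affine< to μ<; iter-affine< to iter-μ<)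

    a^m≡1 : + (a ^ m) ≡ 1ℤ mod p
    a^m≡1 = ≡-mod-trans (≡-mod-sym (%ℕ-mod (+ (a ^ m)))) (≡⇒≡-mod (cong +_ (trans (sym (modN≡% (a ^ m) p)) (proj₁ (proj₂ order)))))

    a^e≢1 : ∀ {e} → 0 < e → e < m → ¬ + (a ^ e) ≡ 1ℤ mod p
    a^e≢1 {e} 0<e e<m h = proj₂ (proj₂ order) e 0<e e<m (trans (modN≡% (a ^ e) p) (trans (≡-mod⇒%ℕ≡ h) (m<n⇒m%n≡m 1<p)))

    1≢0 : ¬ 1ℤ ≡ 0ℤ mod p
    1≢0 h with residue-unique 1<p 0<p h
    ... | ()

    a≡0⇒a^n≡0 : + a ≡ 0ℤ mod p → ∀ {n} → 0 < n → + (a ^ n) ≡ 0ℤ mod p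
    a≡0⇒a^n≡0 a≡0 {suc n} _ = begin
      + (a ^ suc n)        ≡⟨ ℤ.pos-* a (a ^ n) ⟩
      + a * + (a ^ n)      ≈⟨ *-congʳ-mod (+ (a ^ n)) a≡0 ⟩
      0ℤ * + (a ^ n)       ≡⟨ ℤ.*-zeroˡ (+ (a ^ n)) ⟩
      0ℤ                   ∎
      where open ≡-mod-Reasoning p

    a^e≢0 : ∀ e → ¬ + (a ^ e) ≡ 0ℤ mod p
    a^e≢0 zero    = 1≢0
    a^e≢0 (suc e) h with euclid-mod p-prime {+ a} {+ (a ^ e)} (≡-mod-trans (≡⇒≡-mod (sym (ℤ.pos-* a (a ^ e)))) h)
    ... | inj₁ a≡0   = 1≢0 (≡-mod-trans (≡-mod-sym a^m≡1) (a≡0⇒a^n≡0 a≡0 (proj₁ order)))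
    ... | inj₂ a^e≡0 = a^e≢0 e a^e≡0

    iter-μ : ∀ e w → + iter μ e w ≡ + (a ^ e) * + w mod p
    iter-μ e w = ≡-mod-trans (AffineMap.iter-affine-conjugate p 0 a 0-fixed e (≡⇒≡-mod (sym (ℤ.+-identityˡ (+ w)))))
                             (≡⇒≡-mod (ℤ.+-identityˡ _))
      where
      0-fixed : + 0 + + a * + 0 ≡ + 0 mod p
      0-fixed = ≡⇒≡-mod (trans (ℤ.+-identityˡ _) (ℤ.*-zeroʳ (+ a)))

    μ-periodic : ∀ {w} → w < p → iter μ m w ≡ w
    μ-periodic {w} w<p = residue-unique (iter-μ< w<p m) w<p
      (≡-mod-trans (iter-μ m w) (≡-mod-trans (*-congʳ-mod (+ w) a^m≡1) (≡⇒≡-mod (ℤ.*-identityˡ (+ w)))))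

    μ-nonzero : ∀ {w} → 0 < w → w < p → ∀ e → iter μ e w ≢ 0
    μ-nonzero {w} 0<w w<p e eq with euclid-mod p-prime (≡-mod-trans (≡-mod-sym (iter-μ e w)) (≡⇒≡-mod (cong +_ eq)))
    ... | inj₁ a^e≡0 = a^e≢0 e a^e≡0
    ... | inj₂ w≡0   = <⇒≢ 0<w (sym (residue-unique w<p 0<p w≡0))

    μ-exactPeriod : ∀ {w} → 0 < w → w < p → ExactPeriod μ m w
    μ-exactPeriod {w} 0<w w<p = record
      { positive = proj₁ order
      ; periodic = μ-periodic w<p
      ; minimal  = λ e 0<e e<m eq → a^e≢1 0<e e<m (*-cancelʳ-mod p-prime w≢0 (begin
          + (a ^ e) * + w      ≈⟨ ≡-mod-sym (iter-μ e w) ⟩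
          + iter μ e w         ≡⟨ cong +_ eq ⟩
          + w                  ≡⟨ ℤ.*-identityˡ (+ w) ⟨
          1ℤ * + w             ∎))
      }
      where
      open ≡-mod-Reasoning p
      w≢0 : ¬ + w ≡ 0ℤ mod p
      w≢0 w≡0 = <⇒≢ 0<w (sym (residue-unique w<p 0<p w≡0))

    IsLeastInOrbit : ℕ → Set
    IsLeastInOrbit w = 0 < w × (∀ {q} → q < m → w ≤ iter μ q w)

    isLeastInOrbit? : ∀ w → Dec (IsLeastInOrbit w)
    isLeastInOrbit? w = (0 <? w) ×-dec allUpTo? (λ q → w ≤? iter μ q w) m

    least-≤-orbit : ∀ {w} → IsLeastInOrbit w → w < p → ∀ e → w ≤ iter μ e w
    least-≤-orbit {w} (_ , least) w<p e =
      ≤-trans (least (m%n<n e m)) (≤-reflexive (sym (iter-%-periodic μ (μ-periodic w<p) e)))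

    least-unique : ∀ {w w'} → IsLeastInOrbit w → IsLeastInOrbit w' → w < p → w' < p →
                   ∀ e → iter μ e w ≡ w' → w ≡ w'
    least-unique {w} {w'} lw lw' w<p w'<p e eq = ≤-antisym
      (≤-trans (least-≤-orbit lw w<p e) (≤-reflexive eq))
      (≤-trans (least-≤-orbit lw' w'<p (e ℕ.* m ∸ e)) (≤-reflexive (iter-return μ e (μ-periodic w<p) eq)))

    representatives : List ℕ
    representatives = filter isLeastInOrbit? (upTo p)

    ℓ : ℕ
    ℓ = length representatives

    rep : Fin ℓ → ℕ
    rep = lookup representatives

    rep-least : ∀ u → IsLeastInOrbit (rep u) × rep u < p
    rep-least u with ∈-filter⁻ isLeastInOrbit? (∈-lookup {xs = representatives} u)
    ... | rep∈upTo , least = least , ∈-upTo⁻ rep∈upTo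

    rep-disjoint : ∀ {u u'} e → iter μ e (rep u) ≡ rep u' → u ≡ u'
    rep-disjoint {u} {u'} e eq = lookup-injective (filter⁺ isLeastInOrbit? (upTo⁺ p))
      (least-unique (proj₁ (rep-least u)) (proj₁ (rep-least u')) (proj₂ (rep-least u)) (proj₂ (rep-least u')) e eq)

    rep-covering : ∀ {y} → 0 < y → y < p → ∃₂ λ u e → iter μ e (rep u) ≡ y
    rep-covering {y} 0<y y<p = Any.index r∈reps , q₀ ℕ.* m ∸ q₀ ,
      trans (cong (iter μ (q₀ ℕ.* m ∸ q₀)) (sym (lookup-index r∈reps))) (iter-return μ q₀ (μ-periodic y<p) refl)
      where
      orbit : ℕ → ℕ
      orbit q = iter μ q y
      q₀ = argmin orbit 0 (upTo m)
      r = orbit q₀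
      r≤orbit : ∀ {q} → q < m → r ≤ iter μ q r
      r≤orbit {q} q<m = begin
        r                       ≤⟨ All.lookup (f[argmin]≤f[xs] {f = orbit} 0 (upTo m)) (∈-upTo⁺ (m%n<n (q ℕ.+ q₀) m)) ⟩
        orbit ((q ℕ.+ q₀) % m)  ≡⟨ iter-%-periodic μ (μ-periodic y<p) (q ℕ.+ q₀) ⟨
        orbit (q ℕ.+ q₀)        ≡⟨ iter-+ μ q q₀ y ⟩
        iter μ q r              ∎
        where open ≤-Reasoning
      r∈reps : r ∈ representatives
      r∈reps = ∈-filter⁺ isLeastInOrbit? (∈-upTo⁺ (iter-μ< y<p q₀)) (n≢0⇒n>0 (μ-nonzero 0<y y<p q₀) , r≤orbit)

    rep>0 : ∀ u → 0 < rep u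
    rep>0 u = proj₁ (proj₁ (rep-least u))

    rep<p : ∀ u → rep u < p
    rep<p u = proj₂ (rep-least u)

    μ0≡0 : μ 0 ≡ 0
    μ0≡0 = residue-unique (μ< 0) 0<p (≡-mod-trans (iter-μ 1 0) (≡⇒≡-mod (ℤ.*-zeroʳ (+ (a ^ 1)))))

    orbitElement : Fin ℓ → Fin m → ℕ
    orbitElement u q = iter μ (toℕ q) (rep u)

    orbitElement-injective : ∀ {u u' q q'} → orbitElement u q ≡ orbitElement u' q' → u ≡ u' × q ≡ q'
    orbitElement-injective {u} {u'} {q} {q'} eq = sym u'≡u , toℕ-injective
      (exactPeriod-injective μ (μ-exactPeriod (rep>0 u) (rep<p u)) (toℕ<n q) (toℕ<n q')
        (trans eq (cong (λ v → orbitElement v q') u'≡u)))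
      where
      back-to-rep : iter μ (toℕ q ℕ.* m ∸ toℕ q ℕ.+ toℕ q') (rep u') ≡ rep u
      back-to-rep = trans (iter-+ μ (toℕ q ℕ.* m ∸ toℕ q) (toℕ q') (rep u'))
        (trans (cong (iter μ (toℕ q ℕ.* m ∸ toℕ q)) (sym eq)) (iter-return μ (toℕ q) (μ-periodic (rep<p u)) refl))
      u'≡u : u' ≡ u
      u'≡u = rep-disjoint {u'} {u} (toℕ q ℕ.* m ∸ toℕ q ℕ.+ toℕ q') back-to-rep

    private
      orbitElement′ : Fin ℓ × Fin m → ℕ
      orbitElement′ uq = orbitElement (proj₁ uq) (proj₂ uq)

      enumerate : Fin (suc (ℓ ℕ.* m)) → ℕ
      enumerate Fin.zero    = 0
      enumerate (Fin.suc i) = orbitElement′ (remQuot {ℓ} m i)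

      enumerate< : ∀ i → enumerate i < p
      enumerate< Fin.zero    = 0<p
      enumerate< (Fin.suc i) = iter-μ< (rep<p (proj₁ (remQuot {ℓ} m i))) (toℕ (proj₂ (remQuot {ℓ} m i)))

      orbitElement′≢0 : ∀ uq → orbitElement′ uq ≢ 0
      orbitElement′≢0 (u , q) = μ-nonzero (rep>0 u) (rep<p u) (toℕ q)

      orbitElement′-injective : ∀ {uq uq'} → orbitElement′ uq ≡ orbitElement′ uq' → uq ≡ uq'
      orbitElement′-injective {u , q} {u' , q'} eq = ×-≡,≡→≡ (orbitElement-injective {u} {u'} {q} {q'} eq)

      enumerate-injective : ∀ {i j} → enumerate i ≡ enumerate j → i ≡ j
      enumerate-injective {Fin.zero}  {Fin.zero}  _  = refl
      enumerate-injective {Fin.zero}  {Fin.suc j} eq = contradiction (sym eq) (orbitElement′≢0 (remQuot {ℓ} m j))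
      enumerate-injective {Fin.suc i} {Fin.zero}  eq = contradiction eq (orbitElement′≢0 (remQuot {ℓ} m i))
      enumerate-injective {Fin.suc i} {Fin.suc j} eq = cong Fin.suc (trans (sym (combine-remQuot {ℓ} m i))
        (trans (cong (uncurry combine) (orbitElement′-injective {remQuot {ℓ} m i} {remQuot {ℓ} m j} eq)) (combine-remQuot {ℓ} m j)))

      enumerate-onto : ∀ {y} → y < p → ∃ λ i → enumerate i ≡ y
      enumerate-onto {zero}  _   = Fin.zero , refl
      enumerate-onto {suc y} y<p = onto (rep-covering (s≤s z≤n) y<p)
        where
        onto : (∃₂ λ u e → iter μ e (rep u) ≡ suc y) → ∃ λ i → enumerate i ≡ suc y
        onto (u , e , eq) = Fin.suc (combine u q) , (begin
          orbitElement′ (remQuot {ℓ} m (combine u q))          ≡⟨ cong orbitElement′ (remQuot-combine u q) ⟩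
          iter μ (toℕ q) (rep u)                           ≡⟨ cong (λ n → iter μ n (rep u)) (toℕ-fromℕ< (m%n<n e m)) ⟩
          iter μ (e % m) (rep u)                           ≡⟨ iter-%-periodic μ (μ-periodic (rep<p u)) e ⟨
          iter μ e (rep u)                                 ≡⟨ eq ⟩
          suc y                                            ∎)
          where
          open ≡-Reasoning
          q = fromℕ< (m%n<n e m)

    -- 0 and the ℓ orbits of size m exhaust {0, …, p-1}.
    orbit-count : ℓ ≡ (p ∸ 1) / m
    orbit-count = trans (sym (m*n/n≡m ℓ m)) (cong (λ n → (n ∸ 1) / m) (enumeration-size enumerate enumerate< enumerate-injective enumerate-onto))

    linear-decomposition : CycleDecomposition μ p (suc ((p ∸ 1) / m)) (firstThen 1 m)
    linear-decomposition = subst (λ t → CycleDecomposition μ p (suc t) (firstThen 1 m)) orbit-count (record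
      { point       = point
      ; point<      = λ { Fin.zero → 0<p ; (Fin.suc u) → rep<p u }
      ; exactPeriod = λ { Fin.zero → exactPeriod-fixed μ μ0≡0 ; (Fin.suc u) → μ-exactPeriod (rep>0 u) (rep<p u) }
      ; disjoint    = disjoint
      ; covering    = covering
      })
      where
      point : Fin (suc ℓ) → ℕ
      point Fin.zero    = 0
      point (Fin.suc u) = rep u
      disjoint : ∀ {j j'} e → iter μ e (point j) ≡ point j' → j ≡ j'
      disjoint {Fin.zero}  {Fin.zero}   _ _  = refl
      disjoint {Fin.zero}  {Fin.suc u'} e eq = contradiction (trans (sym eq) (iter-fixed μ μ0≡0 e)) (<⇒≢ (rep>0 u') ∘ sym)
      disjoint {Fin.suc u} {Fin.zero}   e eq = contradiction eq (μ-nonzero (rep>0 u) (rep<p u) e)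
      disjoint {Fin.suc u} {Fin.suc u'} e eq = cong Fin.suc (rep-disjoint {u} {u'} e eq)
      covering : ∀ {y} → y < p → ∃₂ λ j e → iter μ e (point j) ≡ y
      covering {zero}  _   = Fin.zero , 0 , refl
      covering {suc y} y<p = let u , e , eq = rep-covering (s≤s z≤n) y<p in Fin.suc u , e , eq

  module _ {p : ℕ} .{{_ : NonZero p}} (p-prime : Prime p) (b a m : ℕ) .{{_ : NonZero m}} (order : IsMultOrder p a m)
           (a≢1 : ¬ + a ≡ 1ℤ mod p) where

    open AffineMap p b a

    private
      t* : ℕ
      t* = fixedPoint p-prime a≢1

      open AffineMap p t* 1 using () renaming (affine to shift; affine< to shift<; affine-≡-mod to shift-≡-mod)
      open AffineMap p 0 a using () renaming (affine to μ; affine< to μ<; affine-≡-mod to μ-≡-mod)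

      shift-≡-mod′ : ∀ w → + shift w ≡ + t* + + w mod p
      shift-≡-mod′ w = ≡-mod-trans (shift-≡-mod w) (≡⇒≡-mod (cong (_+_ (+ t*)) (ℤ.*-identityˡ (+ w))))

      shift-injective : ∀ {x y} → x < p → y < p → shift x ≡ shift y → x ≡ y
      shift-injective {x} {y} x<p y<p eq = residue-unique x<p y<p (+-cancelˡ-mod (+ t*)
        (≡-mod-trans (≡-mod-sym (shift-≡-mod′ x)) (≡-mod-trans (≡⇒≡-mod (cong +_ eq)) (shift-≡-mod′ y))))

      shift-onto : ∀ {y} → y < p → ∃ λ x → x < p × shift x ≡ y
      shift-onto {y} y<p = x , n%ℕd<d (+ y - + t*) p , residue-unique (shift< x) y<p (begin
        + shift x                  ≈⟨ shift-≡-mod′ x ⟩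
        + t* + + x                 ≈⟨ +-congˡ-mod (+ t*) (%ℕ-mod (+ y - + t*)) ⟩
        + t* + (+ y - + t*)        ≡⟨ cancel (+ t*) (+ y) ⟩
        + y                        ∎)
        where
        open ≡-mod-Reasoning p
        x = (+ y - + t*) %ℕ p
        cancel : ∀ t y → t + (y - t) ≡ y
        cancel = solve-∀

      affine∘shift≡shift∘μ : ∀ {x} → x < p → affine (shift x) ≡ shift (μ x)
      affine∘shift≡shift∘μ {x} _ = residue-unique (affine< _) (shift< _) (begin
        + affine (shift x)                 ≈⟨ affine-≡-mod (shift x) ⟩
        + b + + a * + shift x              ≈⟨ +-congˡ-mod (+ b) (*-congˡ-mod (+ a) (shift-≡-mod′ x)) ⟩
        + b + + a * (+ t* + + x)           ≡⟨ regroup (+ b) (+ a) (+ t*) (+ x) ⟩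
        (+ b + + a * + t*) + + a * + x     ≈⟨ +-congʳ-mod (+ a * + x) (fixedPoint-fixed p-prime a≢1) ⟩
        + t* + + a * + x                   ≡⟨ cong (_+_ (+ t*)) (ℤ.+-identityˡ (+ a * + x)) ⟨
        + t* + (+ 0 + + a * + x)           ≈⟨ +-congˡ-mod (+ t*) (≡-mod-sym (μ-≡-mod x)) ⟩
        + t* + + μ x                       ≈⟨ ≡-mod-sym (shift-≡-mod′ (μ x)) ⟩
        + shift (μ x)                      ∎)
        where
        open ≡-mod-Reasoning p
        regroup : ∀ b a t x → b + a * (t + x) ≡ (b + a * t) + a * x
        regroup = solve-∀

    -- Translation by the fixed point conjugates t ↦ b + a t to t ↦ a t.
    affine-decomposition : CycleDecomposition affine p (suc ((p ∸ 1) / m)) (firstThen 1 m)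
    affine-decomposition = conjugate-decomposition (λ _ → μ< _) (λ _ → shift< _) shift-injective shift-onto
      affine∘shift≡shift∘μ (MultiplicativeOrbits.linear-decomposition p p-prime a m order)

module Lifting where

  open Congruence
  open Polynomial
  open FunctionalGraph
  open Affine
  open Cosets using (module MultiplicativeOrbits; affine-decomposition)
  open import Data.Nat.Base as ℕ using (ℕ; zero; suc; _<_; _∸_; _%_; _/_; NonZero; >-nonZero; >-nonZero⁻¹)
  open import Data.Nat.Properties
    using (+-suc; +-identityʳ; *-identityˡ; *-comm; *-cancelʳ-≡; +-cancelˡ-≡; suc-pred; m*n≢0;
           <-≤-trans; +-monoˡ-<; *-monoˡ-≤; n≢0⇒n>0; <⇒≢; _≟_)
  import Data.Nat.Divisibility as ℕ
  open import Data.Nat.DivMod using (m≡m%n+[m/n]*n; m%n<n; m<n⇒m%n≡m; [m+kn]%n≡m%n; m<n*o⇒m/o<n)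
  open import Data.Nat.Primality using (Prime; prime⇒nonTrivial)
  open import Data.Integer.Base using (ℤ; +_; 1ℤ; _+_; _*_; -_; _-_; _%ℕ_; _/ℕ_)
  import Data.Integer.Properties as ℤ
  open import Data.Integer.Divisibility.Signed using (_∣_; ∣n⇒∣m*n; ∣ᵤ⇒∣)
  open import Data.Integer.Tactic.RingSolver using (solve-∀)
  open import Data.Fin.Base as Fin using (Fin; toℕ; fromℕ<)
  open import Data.Product using (∃; ∃₂; _×_; _,_; proj₁; proj₂)
  open import Data.Sum using (_⊎_; inj₁; inj₂)
  open import Function.Bundles using (Equivalence; _⇔_; mk⇔)
  open import Relation.Nullary using (¬_; Dec; yes; no)
  open import Relation.Binary.PropositionalEquality
    using (_≡_; _≢_; refl; sym; trans; cong; cong₂; subst; module ≡-Reasoning)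

  iter-eval-cong-mod : ∀ f j {d x y} → x ≡ y mod d → iter (eval f) j x ≡ iter (eval f) j y mod d
  iter-eval-cong-mod f zero    h = h
  iter-eval-cong-mod f (suc j) h = eval-cong-mod f (iter-eval-cong-mod f j h)

  iter-fmap-≡-mod : ∀ f L .{{_ : NonZero L}} j x → + iter (fmap f L) j x ≡ iter (eval f) j (+ x) mod L
  iter-fmap-≡-mod f L zero    x = ≡-mod-refl
  iter-fmap-≡-mod f L (suc j) x = begin
    + (eval f (+ y) modℤ L)           ≡⟨ cong +_ (modℤ≡%ℕ (eval f (+ y)) L) ⟩
    + (eval f (+ y) %ℕ L)             ≈⟨ %ℕ-mod (eval f (+ y)) ⟩
    eval f (+ y)                      ≈⟨ eval-cong-mod f (iter-fmap-≡-mod f L j x) ⟩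
    eval f (iter (eval f) j (+ x))    ∎
    where
    open ≡-mod-Reasoning L
    y = iter (fmap f L) j x

  module LiftedGraph {p N : ℕ} .{{_ : NonZero p}} .{{_ : NonZero N}} (p∣N : p ℕ.∣ N)
                 {f : Poly} {k : ℕ} (C : Cycle f N k) where

    M : ℕ
    M = p ℕ.* N

    private
      instance
        M≢0 : NonZero M
        M≢0 = m*n≢0 p N
        k≢0 : NonZero k
        k≢0 = >-nonZero (size>0 C)

    F : ℕ → ℕ
    F = fmap f M

    a : ℕ → ℕ
    a = vertex C

    a<N : ∀ s → a s < N
    a<N s = bound C _

    lift : ℕ → ℕ → ℕ
    lift s t = a s ℕ.+ t ℕ.* N

    lift<M : ∀ {s t} → t < p → lift s t < M
    lift<M {s} {t} t<p = <-≤-trans (+-monoˡ-< (t ℕ.* N) (a<N s)) (*-monoˡ-≤ N t<p)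

    lift%N : ∀ s t → lift s t % N ≡ a s
    lift%N s t = trans ([m+kn]%n≡m%n (a s) t N) (m<n⇒m%n≡m (a<N s))

    lift-injective : ∀ {s s' t t'} → lift s t ≡ lift s' t' → a s ≡ a s' × t ≡ t'
    lift-injective {s} {s'} {t} {t'} eq = a≡a' , *-cancelʳ-≡ t t' N (+-cancelˡ-≡ (a s) _ _ (trans eq (cong (ℕ._+ t' ℕ.* N) (sym a≡a'))))
      where
      a≡a' : a s ≡ a s'
      a≡a' = trans (sym (lift%N s t)) (trans (cong (_% N) eq) (lift%N s' t'))

    lift-lifted : ∀ s {t} → t < p → LiftedVertex M C (lift s t)
    lift-lifted s {t} t<p = lift<M t<p , subst (_∈C C) (sym (trans (modN≡% (lift s t) N) (lift%N s t))) (vertex-∈C C s)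

    lifted⇒lift : ∀ {x} → LiftedVertex M C x → ∃₂ λ s t → t < p × x ≡ lift s t
    lifted⇒lift {x} (x<M , i , vert≡x%N) = toℕ i , x / N , m<n*o⇒m/o<n x<M , (begin
      x                       ≡⟨ m≡m%n+[m/n]*n x N ⟩
      x % N ℕ.+ x / N ℕ.* N   ≡⟨ cong (ℕ._+ x / N ℕ.* N) (trans (sym (modN≡% x N)) (trans (sym vert≡x%N) (sym (vertex-toℕ C i)))) ⟩
      lift (toℕ i) (x / N)    ∎)
      where open ≡-Reasoning

    Z : ℕ → ℤ → ℤ
    Z = iter (eval f)

    c : ℕ → ℤ
    c s = eval (deriv f) (+ a s)

    Λ : ℕ → ℕ → ℤ
    Λ s zero    = 1ℤ
    Λ s (suc j) = c s * Λ (suc s) j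

    private
      M∣[uN]² : ∀ u → + M ∣ (u * + N) * (u * + N)
      M∣[uN]² u = subst (+ M ∣_) (square (+ N) u)
        (∣n⇒∣m*n (u * u) (subst (+ M ∣_) (ℤ.pos-* N N) (∣ᵤ⇒∣ {+ M} {+ (N ℕ.* N)} (ℕ.*-monoˡ-∣ N p∣N))))
        where
        square : ∀ n u → u * u * (n * n) ≡ (u * n) * (u * n)
        square = solve-∀

    taylor-step : ∀ s {y} u → y ≡ + a s mod N → eval f (y + u * + N) ≡ eval f y + u * c s * + N mod M
    taylor-step s {y} u y≡aₛ = begin
      eval f (y + u * + N)                          ≈⟨ taylor-mod f y (u * + N) (M∣[uN]² u) ⟩
      eval f y + u * + N * eval (deriv f) y         ≡⟨ cong (_+_ (eval f y)) (swap u (+ N) (eval (deriv f) y)) ⟩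
      eval f y + u * eval (deriv f) y * + N         ≈⟨ +-congˡ-mod (eval f y) (*-scale-mod N (*-congˡ-mod u f'y≡cₛ)) ⟩
      eval f y + u * c s * + N                      ∎
      where
      open ≡-mod-Reasoning M
      f'y≡cₛ : eval (deriv f) y ≡ c s mod p
      f'y≡cₛ = eval-cong-mod (deriv f) (≡-mod-divisor p∣N y≡aₛ)
      swap : ∀ u n d → u * n * d ≡ u * d * n
      swap = solve-∀

    orbit-≡-mod : ∀ j s → Z j (+ a s) ≡ + a (j ℕ.+ s) mod N
    orbit-≡-mod j s = ≡-mod-trans (≡-mod-sym (iter-fmap-≡-mod f N j (a s))) (≡⇒≡-mod (cong +_ (iter-vertex C j s)))

    orbit-taylor : ∀ j s {y} u → y ≡ + a s mod N → Z j (y + u * + N) ≡ Z j y + u * + N * Λ s j mod M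
    orbit-taylor zero    s {y} u _     = ≡⇒≡-mod (cong (_+_ y) (sym (ℤ.*-identityʳ (u * + N))))
    orbit-taylor (suc j) s {y} u y≡aₛ = begin
      Z (suc j) (y + u * + N)                       ≡⟨ iter-sucʳ (eval f) j (y + u * + N) ⟩
      Z j (eval f (y + u * + N))                    ≈⟨ iter-eval-cong-mod f j (taylor-step s u y≡aₛ) ⟩
      Z j (eval f y + u * c s * + N)                ≈⟨ orbit-taylor j (suc s) (u * c s) fy≡aₛ₊₁ ⟩
      Z j (eval f y) + u * c s * + N * Λ (suc s) j  ≡⟨ cong₂ _+_ (sym (iter-sucʳ (eval f) j y)) (regroup u (c s) (+ N) (Λ (suc s) j)) ⟩
      Z (suc j) y + u * + N * Λ s (suc j)           ∎
      where
      open ≡-mod-Reasoning M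
      fy≡aₛ₊₁ : eval f y ≡ + a (suc s) mod N
      fy≡aₛ₊₁ = ≡-mod-trans (eval-cong-mod f y≡aₛ) (orbit-≡-mod 1 s)
      regroup : ∀ u c n l → u * c * n * l ≡ u * n * (c * l)
      regroup = solve-∀

    iter-lift : ∀ j s {t} q → t < p → Z j (+ a s) ≡ + a (j ℕ.+ s) + q * + N →
                iter F j (lift s t) ≡ lift (j ℕ.+ s) ((q + Λ s j * + t) modℤ p)
    iter-lift j s {t} q t<p orbit≡ = residue-unique (iter-fmap< f (lift<M {s} t<p) j) (lift<M (modℤ< X p)) (begin
      + iter F j (lift s t)                          ≈⟨ iter-fmap-≡-mod f M j (lift s t) ⟩
      Z j (+ lift s t)                               ≡⟨ cong (Z j) (pos-+-* (a s) t N) ⟩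
      Z j (+ a s + + t * + N)                        ≈⟨ orbit-taylor j s (+ t) ≡-mod-refl ⟩
      Z j (+ a s) + + t * + N * Λ s j                ≡⟨ cong (λ z → z + + t * + N * Λ s j) orbit≡ ⟩
      + a (j ℕ.+ s) + q * + N + + t * + N * Λ s j    ≡⟨ regroup (+ a (j ℕ.+ s)) q (+ t) (+ N) (Λ s j) ⟩
      + a (j ℕ.+ s) + X * + N                        ≈⟨ +-congˡ-mod (+ a (j ℕ.+ s)) (*-scale-mod N (≡-mod-sym (%ℕ-mod X))) ⟩
      + a (j ℕ.+ s) + + (X %ℕ p) * + N               ≡⟨ cong (λ r → + a (j ℕ.+ s) + + r * + N) (modℤ≡%ℕ X p) ⟨
      + a (j ℕ.+ s) + + (X modℤ p) * + N             ≡⟨ pos-+-* (a (j ℕ.+ s)) (X modℤ p) N ⟨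
      + lift (j ℕ.+ s) (X modℤ p)                    ∎)
      where
      open ≡-mod-Reasoning M
      X = q + Λ s j * + t
      regroup : ∀ a q t n l → a + q * n + t * n * l ≡ a + (q + l * t) * n
      regroup = solve-∀

    iter-lift-fibre : ∀ j s {t} → t < p → ∃ λ t' → t' < p × iter F j (lift s t) ≡ lift (j ℕ.+ s) t'
    iter-lift-fibre j s {t} t<p = _ , modℤ< (q + Λ s j * + t) p , iter-lift j s q t<p (≡-mod⇒≡+quotient (orbit-≡-mod j s))
      where q = (Z j (+ a s) - + a (j ℕ.+ s)) /ℕ N

    Λ-snoc : ∀ j s → Λ s (suc j) ≡ Λ s j * c (j ℕ.+ s)
    Λ-snoc zero    s = trans (ℤ.*-identityʳ (c s)) (sym (ℤ.*-identityˡ (c s)))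
    Λ-snoc (suc j) s = begin
      c s * Λ (suc s) (suc j)              ≡⟨ cong (_*_ (c s)) (Λ-snoc j (suc s)) ⟩
      c s * (Λ (suc s) j * c (j ℕ.+ suc s)) ≡⟨ ℤ.*-assoc (c s) (Λ (suc s) j) _ ⟨
      c s * Λ (suc s) j * c (j ℕ.+ suc s)   ≡⟨ cong (λ n → c s * Λ (suc s) j * c n) (+-suc j s) ⟩
      c s * Λ (suc s) j * c (suc j ℕ.+ s)   ∎
      where open ≡-Reasoning

    Λ-rotate : ∀ s → Λ (suc s) k ≡ Λ s k
    Λ-rotate s = subst (λ n → Λ (suc s) n ≡ Λ s n) (suc-pred k) (begin
      Λ (suc s) (suc (ℕ.pred k))                     ≡⟨ Λ-snoc (ℕ.pred k) (suc s) ⟩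
      Λ (suc s) (ℕ.pred k) * c (ℕ.pred k ℕ.+ suc s)  ≡⟨ cong (_*_ (Λ (suc s) (ℕ.pred k))) c-wraps ⟩
      Λ (suc s) (ℕ.pred k) * c s                     ≡⟨ ℤ.*-comm (Λ (suc s) (ℕ.pred k)) (c s) ⟩
      Λ s (suc (ℕ.pred k))                           ∎)
      where
      open ≡-Reasoning
      c-wraps : c (ℕ.pred k ℕ.+ suc s) ≡ c s
      c-wraps = trans (cong c (trans (+-suc (ℕ.pred k) s) (cong (ℕ._+ s) (suc-pred k))))
                      (cong (λ v → eval (deriv f) (+ v)) (vertex-+k C s))

    Λ≡Λ₀ : ∀ s → Λ s k ≡ Λ 0 k
    Λ≡Λ₀ zero    = refl
    Λ≡Λ₀ (suc s) = trans (Λ-rotate s) (Λ≡Λ₀ s)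

    prodFin≡Λ : ∀ {j} (g : Fin j → ℤ) s → (∀ i → g i ≡ c (toℕ i ℕ.+ s)) → prodFin g ≡ Λ s j
    prodFin≡Λ {zero}  g s h = refl
    prodFin≡Λ {suc j} g s h = cong₂ _*_ (h Fin.zero)
      (prodFin≡Λ (λ i → g (Fin.suc i)) (suc s) (λ i → trans (h (Fin.suc i)) (cong c (sym (+-suc (toℕ i) s)))))

    Λ≡multiplier : ∀ s → Λ s k ≡ multiplier C
    Λ≡multiplier s = trans (Λ≡Λ₀ s) (sym (prodFin≡Λ _ 0 (λ i →
      cong (λ v → eval (deriv f) (+ v)) (trans (sym (vertex-toℕ C i)) (cong a (sym (+-identityʳ (toℕ i))))))))

    R : ℕ → ℤ
    R s = (Z k (+ a s) - + a s) divℤ N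

    r : ℕ → ℕ
    r s = R s modℤ p

    mult : ℕ
    mult = multiplierBar p C

    -- F^k maps each lift s t to lift s (returnMap s t) (iter-k-lift).
    returnMap : ℕ → ℕ → ℕ
    returnMap s = AffineMap.affine p (r s) mult

    orbit-return : ∀ s → Z k (+ a s) ≡ + a (k ℕ.+ s) + R s * + N
    orbit-return s = begin
      Z k (+ a s)                                  ≡⟨ ≡-mod⇒≡+quotient (≡-mod-trans (orbit-≡-mod k s) (≡⇒≡-mod (cong +_ (vertex-+k C s)))) ⟩
      + a s + ((Z k (+ a s) - + a s) /ℕ N) * + N   ≡⟨ cong₂ (λ v q → + v + q * + N) (sym (vertex-+k C s)) (sym (divℤ≡/ℕ _ N)) ⟩
      + a (k ℕ.+ s) + R s * + N                    ∎
      where open ≡-Reasoning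

    iter-k-lift : ∀ s {t} → t < p → iter F k (lift s t) ≡ lift s (returnMap s t)
    iter-k-lift s {t} t<p = trans (iter-lift k s (R s) t<p (orbit-return s))
      (cong₂ (λ v h → v ℕ.+ h ℕ.* N) (vertex-+k C s) (residue-unique (modℤ< _ p) (AffineMap.affine< p (r s) mult t) (begin
        + ((R s + Λ s k * + t) modℤ p)     ≈⟨ modℤ-mod (R s + Λ s k * + t) p ⟩
        R s + Λ s k * + t                  ≡⟨ cong (λ l → R s + l * + t) (Λ≡multiplier s) ⟩
        R s + multiplier C * + t           ≈⟨ +-cong-mod (≡-mod-sym (modℤ-mod (R s) p)) (*-congʳ-mod (+ t) (≡-mod-sym (modℤ-mod (multiplier C) p))) ⟩
        + r s + + mult * + t               ≈⟨ ≡-mod-sym (AffineMap.affine-≡-mod p (r s) mult t) ⟩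
        + returnMap s t                    ∎)))
      where open ≡-mod-Reasoning p

    iter-returnMap< : ∀ s {t} → t < p → ∀ e → iter (returnMap s) e t < p
    iter-returnMap< s = AffineMap.iter-affine< p (r s) mult

    iter-*k-lift : ∀ s e {t} → t < p → iter F (e ℕ.* k) (lift s t) ≡ lift s (iter (returnMap s) e t)
    iter-*k-lift s zero    t<p = refl
    iter-*k-lift s (suc e) t<p = trans (iter-+ F k (e ℕ.* k) _)
      (trans (cong (iter F k) (iter-*k-lift s e t<p)) (iter-k-lift s (iter-returnMap< s t<p e)))

    lift-return : ∀ s j {t t'} → t < p → t' < p → iter F j (lift s t) ≡ lift s t' →
                  j % k ≡ 0 × iter (returnMap s) (j / k) t ≡ t'
    lift-return s j {t} {t'} t<p t'<p eq = j%k≡0 , proj₂ (lift-injective {s} {s} {T} {t'} returns)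
      where
      T = iter (returnMap s) (j / k) t
      split : iter F j (lift s t) ≡ iter F (j % k) (lift s T)
      split = trans (cong (λ n → iter F n (lift s t)) (m≡m%n+[m/n]*n j k))
        (trans (iter-+ F (j % k) _ _) (cong (iter F (j % k)) (iter-*k-lift s (j / k) t<p)))
      landing = iter-lift-fibre (j % k) s (iter-returnMap< s t<p (j / k))
      t'' = proj₁ landing
      same-base : a (j % k ℕ.+ s) ≡ a s
      same-base = proj₁ (lift-injective {j % k ℕ.+ s} {s} {t''} {t'} (trans (sym (proj₂ (proj₂ landing))) (trans (sym split) eq)))
      j%k≡0 : j % k ≡ 0
      j%k≡0 = residue-unique (m%n<n j k) (>-nonZero⁻¹ k) (+-cancelʳ-mod (+ s) (begin
        + (j % k) + + s      ≡⟨ ℤ.pos-+ (j % k) s ⟨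
        + (j % k ℕ.+ s)      ≈⟨ %≡%⇒≡-mod (vertex-injective C same-base) ⟩
        + s                  ≡⟨ ℤ.+-identityˡ (+ s) ⟨
        + 0 + + s            ∎))
        where open ≡-mod-Reasoning k
      returns : lift s T ≡ lift s t'
      returns = trans (cong (λ n → iter F n (lift s T)) (sym j%k≡0)) (trans (sym split) eq)

    lift-exactPeriod : ∀ s {d t} → t < p → ExactPeriod (returnMap s) d t → ExactPeriod F (d ℕ.* k) (lift s t)
    lift-exactPeriod s {d} {t} t<p ep = record
      { positive = >-nonZero⁻¹ (d ℕ.* k) {{m*n≢0 d k {{>-nonZero positive}}}}
      ; periodic = trans (iter-*k-lift s d t<p) (cong (lift s) periodic)
      ; minimal  = early-return
      }
      where
      open ExactPeriod ep
      early-return : ∀ j → 0 < j → j < d ℕ.* k → iter F j (lift s t) ≢ lift s t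
      early-return j 0<j j<dk eq = minimal (j / k) 0<j/k (m<n*o⇒m/o<n j<dk) (proj₂ (lift-return s j t<p t<p eq))
        where
        0<j/k : 0 < j / k
        0<j/k = n≢0⇒n>0 (λ j/k≡0 → <⇒≢ 0<j (sym (trans (m≡m%n+[m/n]*n j k)
          (cong₂ (λ x y → x ℕ.+ y ℕ.* k) (proj₁ (lift-return s j t<p t<p eq)) j/k≡0))))

    lifted-elim : ∀ {P : ℕ → Set} → (∀ s {t} → t < p → P (lift s t)) → ∀ {x} → LiftedVertex M C x → P x
    lifted-elim {P} h lx = let s , t , t<p , x≡ = lifted⇒lift lx in subst P (sym x≡) (h s t<p)

    iter-lifted : ∀ {x} → LiftedVertex M C x → ∀ j → LiftedVertex M C (iter F j x)
    iter-lifted lx j = lifted-elim {λ x → LiftedVertex M C (iter F j x)} (λ s t<p → let t' , t'<p , eq = iter-lift-fibre j s t<p in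
      subst (LiftedVertex M C) (sym eq) (lift-lifted (j ℕ.+ s) t'<p)) lx

    reach-fibre : ∀ {x} → LiftedVertex M C x → ∀ s → ∃₂ λ j t → t < p × iter F j x ≡ lift s t
    reach-fibre lx s = lifted-elim {λ x → ∃₂ λ j t → t < p × iter F j x ≡ lift s t} reach lx
      where
      reach : ∀ s' {t} → t < p → ∃₂ λ j t' → t' < p × iter F j (lift s' t) ≡ lift s t'
      reach s' t<p = j , t' , t'<p , trans eq (cong (λ v → v ℕ.+ t' ℕ.* N) (trans (sym (iter-vertex C j s')) base-reach))
        where
        base = ∈C-reachable C (vertex-∈C C s') (vertex-∈C C s)
        j = proj₁ base
        base-reach = proj₂ base
        lands = iter-lift-fibre j s' t<p
        t' = proj₁ lands
        t'<p = proj₁ (proj₂ lands)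
        eq = proj₂ (proj₂ lands)

    lifted-periodic : ∀ {P} → (∀ s {t} → t < p → iter (returnMap s) P t ≡ t) →
                      ∀ {x} → LiftedVertex M C x → iter F (P ℕ.* k) x ≡ x
    lifted-periodic {P} per = lifted-elim {λ x → iter F (P ℕ.* k) x ≡ x}
      (λ s t<p → trans (iter-*k-lift s P t<p) (cong (lift s) (per s t<p)))

    module _ s {d t} (sz : ℕ) (d*k≡sz : d ℕ.* k ≡ sz) (t<p : t < p) (ep : ExactPeriod (returnMap s) d t) where

      private
        lift-period : ExactPeriod F sz (lift s t)
        lift-period = subst (λ n → ExactPeriod F n (lift s t)) d*k≡sz (lift-exactPeriod s t<p ep)

      liftCycle : Cycle f M sz
      liftCycle = cycleThrough (lift<M t<p) lift-period

      liftCycle-lifted : LiftedCycle C liftCycle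
      liftCycle-lifted i = iter-lifted (lift-lifted s t<p) (toℕ i)

      lift-∈-liftCycle : lift s t ∈C liftCycle
      lift-∈-liftCycle = ∈-cycleThrough {f} (lift<M t<p) lift-period

    cycleDecomposition⇒ConsistsOf : ∀ s {P} → 0 < P → (∀ s' {t} → t < p → iter (returnMap s') P t ≡ t) →
                      ∀ {n size} → CycleDecomposition (returnMap s) p n size →
                      (sz : Fin n → ℕ) → (∀ j → size j ℕ.* k ≡ sz j) → ConsistsOf M C n sz
    cycleDecomposition⇒ConsistsOf s {P} 0<P per cd sz size*k≡sz = D , D-lifted , distinct , covered
      where
      open CycleDecomposition cd
      D : ∀ j → Cycle f M (sz j)
      D j = liftCycle s (sz j) (size*k≡sz j) (point< j) (exactPeriod j)
      D-lifted : ∀ j → LiftedCycle C (D j)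
      D-lifted j = liftCycle-lifted s (sz j) (size*k≡sz j) (point< j) (exactPeriod j)
      lift∈D : ∀ j → lift s (point j) ∈C D j
      lift∈D j = lift-∈-liftCycle s (sz j) (size*k≡sz j) (point< j) (exactPeriod j)
      distinct : ∀ j j' → j ≢ j' → ¬ SameCycle (D j) (D j')
      distinct j j' j≢j' same = j≢j' (disjoint (e / k) (proj₂ (lift-return s e (point< j) (point< j') reaches)))
        where
        reach = ∈C-reachable (D j) (lift∈D j) (Equivalence.from (same (lift s (point j'))) (lift∈D j'))
        e = proj₁ reach
        reaches = proj₂ reach
      covered : ∀ x → LiftedVertex M C x → ∃ λ j → x ∈C D j
      covered x lx = j , periodic-∈C (D j) i {{m*n≢0 P k {{>-nonZero 0<P}}}} (lifted-periodic {P} per lx)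
        (subst (_∈C D j) (trans (iter-*k-lift s e (point< j)) (trans (cong (lift s) returns) (sym eq)))
          (iter-∈C (D j) (e ℕ.* k) (lift∈D j)))
        where
        fibre = reach-fibre lx s
        i = proj₁ fibre
        t<p = proj₁ (proj₂ (proj₂ fibre))
        eq = proj₂ (proj₂ (proj₂ fibre))
        origin = covering t<p
        j = proj₁ origin
        e = proj₁ (proj₂ origin)
        returns = proj₂ (proj₂ origin)

    constantReturn⇒ExactlyOneCycle : (∀ t → returnMap 0 t ≡ returnMap 0 0) → ExactlyOneCycle M C k
    constantReturn⇒ExactlyOneCycle constant = D , liftCycle-lifted 0 k (*-identityˡ k) t*<p fixed , unique
      where
      t* = returnMap 0 0
      t*<p : t* < p
      t*<p = AffineMap.affine< p (r 0) mult 0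
      fixed : ExactPeriod (returnMap 0) 1 t*
      fixed = exactPeriod-fixed (returnMap 0) (constant t*)
      D : Cycle f M k
      D = liftCycle 0 k (*-identityˡ k) t*<p fixed
      unique : ∀ k' (E : Cycle f M k') → LiftedCycle C E → SameCycle E D
      unique k' E E-lifted = shared-vertex⇒SameCycle E D
        (subst (_∈C E) lands (iter-∈C E (k ℕ.+ i) (i₀ , refl))) (lift-∈-liftCycle 0 k (*-identityˡ k) t*<p fixed)
        where
        i₀ = fromℕ< (size>0 E)
        fibre = reach-fibre (E-lifted i₀) 0
        i = proj₁ fibre
        t = proj₁ (proj₂ fibre)
        t<p = proj₁ (proj₂ (proj₂ fibre))
        lands : iter F (k ℕ.+ i) (vert E i₀) ≡ lift 0 t*
        lands = trans (iter-+ F k i _) (trans (cong (iter F k) (proj₂ (proj₂ (proj₂ fibre))))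
          (trans (iter-k-lift 0 t<p) (cong (lift 0) (constant t))))

    size-k-cycles⇒r≡0 : ∀ {n} → ConsistsOf M C n (λ _ → k) → ∀ s → r s ≡ 0
    size-k-cycles⇒r≡0 (D , _ , _ , covered) s = sym (residue-unique 0<p (modℤ< (R s) p) (begin
      + 0                        ≡⟨ cong +_ ψ0≡0 ⟨
      + returnMap s 0            ≈⟨ AffineMap.affine-≡-mod p (r s) mult 0 ⟩
      + r s + + mult * + 0       ≡⟨ trans (cong (_+_ (+ r s)) (ℤ.*-zeroʳ (+ mult))) (ℤ.+-identityʳ (+ r s)) ⟩
      + r s                      ∎))
      where
      open ≡-mod-Reasoning p
      0<p = >-nonZero⁻¹ p
      j = proj₁ (covered (lift s 0) (lift-lifted s 0<p))
      ψ0≡0 : returnMap s 0 ≡ 0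
      ψ0≡0 = proj₂ (lift-injective {s} {s} {returnMap s 0} {0}
        (trans (sym (iter-k-lift s 0<p)) (∈C-periodic (D j) (proj₂ (covered (lift s 0) (lift-lifted s 0<p))))))

    multiplier≡0⇒exactlyOneCycle : mult ≡ 0 → ExactlyOneCycle M C k
    multiplier≡0⇒exactlyOneCycle mult≡0 = constantReturn⇒ExactlyOneCycle (AffineMap.affine-constant p (r 0) mult mult≡0)

    module _ (mult≡1 : mult ≡ 1) where

      private
        translations-periodic : ∀ s {t} → t < p → iter (returnMap s) p t ≡ t
        translations-periodic s = AffineMap.translation-periodic p (r s) mult mult≡1

      r≡0⇒p-cycles : ∀ s → r s ≡ 0 → ConsistsOf M C p (λ _ → k)
      r≡0⇒p-cycles s r≡0 = cycleDecomposition⇒ConsistsOf s (>-nonZero⁻¹ p) translations-periodic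
        (AffineMap.identity-decomposition p (r s) mult mult≡1 r≡0) (λ _ → k) (λ _ → *-identityˡ k)

      p-cycles⇔r≡0 : ∀ s → ConsistsOf M C p (λ _ → k) ⇔ (r s ≡ 0)
      p-cycles⇔r≡0 s = mk⇔ (λ cs → size-k-cycles⇒r≡0 cs s) (r≡0⇒p-cycles s)

      one-cycle-or-p-cycles : Prime p → ConsistsOf M C 1 (λ _ → k ℕ.* p) ⊎ ConsistsOf M C p (λ _ → k)
      one-cycle-or-p-cycles p-prime = cases (r 0 ≟ 0)
        where
        cases : Dec (r 0 ≡ 0) → ConsistsOf M C 1 (λ _ → k ℕ.* p) ⊎ ConsistsOf M C p (λ _ → k)
        cases (yes r₀≡0) = inj₂ (r≡0⇒p-cycles 0 r₀≡0)
        cases (no  r₀≢0) = inj₁ (cycleDecomposition⇒ConsistsOf 0 (>-nonZero⁻¹ p) translations-periodic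
          (AffineMap.translation-decomposition p (r 0) mult mult≡1 p-prime
            (λ r₀≡0 → r₀≢0 (residue-unique (modℤ< (R 0) p) (>-nonZero⁻¹ p) r₀≡0)))
          (λ _ → k ℕ.* p) (λ _ → *-comm p k))

    multiplierOrder⇒cycles : Prime p → mult ≢ 1 → ∀ m .{{_ : NonZero m}} → IsMultOrder p mult m →
                             ConsistsOf M C (suc ((p ∸ 1) / m)) (firstThen k (m ℕ.* k))
    multiplierOrder⇒cycles p-prime mult≢1 m order = cycleDecomposition⇒ConsistsOf 0 (proj₁ order)
      (λ s → AffineMap.affine-order-periodic p (r s) mult p-prime mult≢1-mod {m} (MultiplicativeOrbits.a^m≡1 p p-prime mult m order))
      (affine-decomposition p-prime (r 0) mult m order mult≢1-mod) (firstThen k (m ℕ.* k)) sizes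
      where
      mult≢1-mod : ¬ + mult ≡ 1ℤ mod p
      mult≢1-mod h = mult≢1 (residue-unique (modℤ< (multiplier C) p) (ℕ.nonTrivial⇒n>1 p {{prime⇒nonTrivial p-prime}}) h)
      sizes : ∀ j → firstThen 1 m j ℕ.* k ≡ firstThen k (m ℕ.* k) j
      sizes Fin.zero    = *-identityˡ k
      sizes (Fin.suc _) = refl

open import Data.Nat using (ℕ; suc; _≤_; _*_; _^_; _∸_; _/_; NonZero; s≤s; z≤n)
open import Data.Nat.Properties using (m^n≢0)
open import Data.Nat.Divisibility using (m∣m*n)
open import Data.Nat.Primality using (Prime; prime⇒nonZero)
open import Data.Integer.Base using (+_; _-_)
open import Data.Fin.Base using (toℕ)
open import Data.Product using (_×_; _,_)
open import Data.Sum using (_⊎_)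
open import Function.Bundles using (_⇔_)
open import Relation.Binary.PropositionalEquality using (_≡_; _≢_; cong; sym; subst)
open FunctionalGraph using (vertex-toℕ)
open Lifting

theorem4p3 : (p n : ℕ) → Prime p → 1 ≤ n → (f : Poly) (k : ℕ) (C : Cycle f (p ^ n) k) →
    (multiplierBar p C ≡ 0 → ExactlyOneCycle (p ^ suc n) C k)
    ×
    (multiplierBar p C ≡ 1 →
      (ConsistsOf (p ^ suc n) C 1 (λ _ → k * p) ⊎ ConsistsOf (p ^ suc n) C p (λ _ → k))
      × (∀ i → ConsistsOf (p ^ suc n) C p (λ _ → k) ⇔ (rVertex p n C i ≡ 0)))
    ×
    (multiplierBar p C ≢ 0 → multiplierBar p C ≢ 1 →
      ∀ m → .{{_ : NonZero m}} → IsMultOrder p (multiplierBar p C) m →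
      ConsistsOf (p ^ suc n) C (suc ((p ∸ 1) / m)) (firstThen k (m * k)))
theorem4p3 p (suc n) p-prime (s≤s z≤n) f k C =
  multiplier≡0⇒exactlyOneCycle ,
  (λ mult≡1 → one-cycle-or-p-cycles mult≡1 p-prime , p-cycles⇔rVertex≡0 mult≡1) ,
  (λ _ → multiplierOrder⇒cycles p-prime)
  where
  instance
    p≢0 : NonZero p
    p≢0 = prime⇒nonZero p-prime
    pⁿ≢0 : NonZero (p ^ suc n)
    pⁿ≢0 = m^n≢0 p (suc n)
  open LiftedGraph (m∣m*n (p ^ n)) C
  p-cycles⇔rVertex≡0 : mult ≡ 1 → ∀ i → ConsistsOf M C p (λ _ → k) ⇔ (rVertex p (suc n) C i ≡ 0)
  p-cycles⇔rVertex≡0 mult≡1 i =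
    subst (λ v → ConsistsOf M C p (λ _ → k) ⇔ (v ≡ 0)) (sym rVertex≡r) (p-cycles⇔r≡0 mult≡1 (toℕ i))
    where
    rVertex≡r : rVertex p (suc n) C i ≡ r (toℕ i)
    rVertex≡r = cong (λ v → ((iter (eval f) k (+ v) - + v) divℤ (p ^ suc n)) modℤ p) (sym (vertex-toℕ C i))
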